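{- Let $m\ge 1$ and let $\underline{r}=(r_1,\dots,r_m)$ be pairwise coprime integers $r_i\ge 2$. For $n\ge0$ let $CP_{\underline{r},n}$ be the set of partitions of $n$ none of whose parts is divisible by any $r_l$, let $m_i(\rho)$ denote the multiplicity of $i$ in a partition $\rho$, let $W_{\underline{r},s,n}=\sum_{\rho\in CP_{\underline{r},n}}|\{i\ge1\mid m_i(\rho)\ge s\}|$, and for $1\le i\le m$ let $$c_{r_i,n}=\sum_{\substack{j\ge 1\\ r_l\nmid j \text{ for all } l}}\ \sum_{k_1,\dots,k_m\ge0} k_i\, W_{\underline{r},\,r_1^{k_1}\cdots r_m^{k_m}j,\,n}.$$ Let $\Phi_{\underline{r}}(q)=\prod_{n\ge1,\ r_l\nmid n\ \forall l}(1-q^n)^{ -1}=\sum_{n\ge0}|CP_{\underline{r},n}|q^n$. Then for each $1\le i\le m$, $$\sum_{n\ge0}c_{r_i,n}q^n=\Phi_{\underline{r}}(q)\left(\sum_{n\ge1}\frac{q^{r_in}}{1-q^{r_in}}+\sum_{k=1}^{m-1}(-1)^k\sum_{\substack{1\le l_1<\dots<l_k\le m\\ l_1,\dots,l_k\ne i}}\ \sum_{n\ge1}\frac{q^{r_ir_{l_1}\cdots r_{l_k}n}}{1-q^{r_ir_{l_1}\cdots r_{l_k}n}}\right)=\Phi_{\underline{r}}(q)\sum_{\substack{n\ge1\\ r_l\nmid n\ \forall l\ne i}}\frac{q^{r_in}}{1-q^{r_in}}.$$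
   Context: Identities are of formal power series in $q$. -}

module Defs where

open import Data.Nat as ℕ using (ℕ; zero; suc; _≡ᵇ_; _≤ᵇ_; _∸_)
open import Data.Nat.Divisibility using (_∣?_)
open import Data.Integer as ℤ using (ℤ; +_; -[1+_])
open import Data.Fin using (Fin; zero; suc; toℕ; _≟_)
open import Data.Vec using (Vec; []; _∷_; lookup)
open import Data.List using (List; []; _∷_; map; concatMap; filterᵇ; length; upTo)
open import Data.Nat.ListAction using (sum)
open import Data.Bool using (Bool; true; false; if_then_else_; not; _∧_; _∨_)
open import Relation.Nullary.Decidable using (does)

sumℕ< : ℕ → (ℕ → ℕ) → ℕ
sumℕ< zero f = 0
sumℕ< (suc n) f = sumℕ< n f ℕ.+ f n

sumℤ< : ℕ → (ℕ → ℤ) → ℤ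
sumℤ< zero f = + 0
sumℤ< (suc n) f = sumℤ< n f ℤ.+ f n

sumFin : ∀ {m} → (Fin m → ℕ) → ℕ
sumFin {zero} f = 0
sumFin {suc m} f = f zero ℕ.+ sumFin (λ l → f (suc l))

prodFin : ∀ {m} → (Fin m → ℕ) → ℕ
prodFin {zero} f = 1
prodFin {suc m} f = f zero ℕ.* prodFin (λ l → f (suc l))

anyFin : ∀ {m} → (Fin m → Bool) → Bool
anyFin {zero} f = false
anyFin {suc m} f = f zero ∨ anyFin (λ l → f (suc l))

allFin : ∀ {m} → (Fin m → Bool) → Bool
allFin {zero} f = true
allFin {suc m} f = f zero ∧ allFin (λ l → f (suc l))

countFin : ∀ {m} → (Fin m → Bool) → ℕ
countFin f = sumFin (λ l → if f l then 1 else 0)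

vecsBounded : (len b : ℕ) → List (Vec ℕ len)
vecsBounded zero b = [] ∷ []
vecsBounded (suc len) b =
  concatMap (λ x → map (x ∷_) (vecsBounded len b)) (upTo (suc b))

subsets : (m : ℕ) → List (Vec Bool m)
subsets zero = [] ∷ []
subsets (suc m) = concatMap (λ x → map (x ∷_) (subsets m)) (true ∷ false ∷ [])

rFree : ∀ {m} → (Fin m → ℕ) → ℕ → Bool
rFree r n = not (anyFin (λ l → does (r l ∣? n)))

rFreeExcept : ∀ {m} → (Fin m → ℕ) → Fin m → ℕ → Bool
rFreeExcept r i n = allFin (λ l → does (l ≟ i) ∨ not (does (r l ∣? n)))

-- A partition ρ of n is encoded by its multiplicity vector v : Vec ℕ n,
-- where  lookup v p = m_{p+1}(ρ)  (parts of a partition of n are ≤ n).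
-- v encodes a partition of n iff Σ_p (p+1)·v_p = n; each multiplicity
-- is then ≤ n, so all such v occur in  vecsBounded n n.

weight : ∀ {len} → Vec ℕ len → ℕ
weight v = sumFin (λ p → suc (toℕ p) ℕ.* lookup v p)

partsOK : ∀ {m len} → (Fin m → ℕ) → Vec ℕ len → Bool
partsOK r v = allFin (λ p → (lookup v p ≡ᵇ 0) ∨ rFree r (suc (toℕ p)))

CP : ∀ {m} → (Fin m → ℕ) → (n : ℕ) → List (Vec ℕ n)
CP r n = filterᵇ (λ v → (weight v ≡ᵇ n) ∧ partsOK r v) (vecsBounded n n)

bigMults : ∀ {len} → ℕ → Vec ℕ len → ℕ
bigMults s v = countFin (λ p → s ≤ᵇ lookup v p)

W : ∀ {m} → (Fin m → ℕ) → (s n : ℕ) → ℕ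
W r s n = sum (map (bigMults s) (CP r n))

powProd : ∀ {m} → (Fin m → ℕ) → Vec ℕ m → ℕ
powProd r k = prodFin (λ l → r l ℕ.^ lookup k l)

-- c_{r_i,n}.  The infinite sums over j ≥ 1 and k_1,…,k_m ≥ 0 are
-- truncated to j ≤ n and k_l ≤ n: beyond these bounds
-- s = r^k j > n, hence W_{r,s,n} = 0, so the dropped terms are all 0.
c : ∀ {m} → (Fin m → ℕ) → Fin m → ℕ → ℕ
c {m} r i n =
  sumℕ< n (λ j′ → let j = suc j′ in
    if rFree r j
    then sum (map (λ k → lookup k i ℕ.* W r (powProd r k ℕ.* j) n)
                  (vecsBounded m n))
    else 0)

Series : Set
Series = ℕ → ℤ

zeroS : Series
zeroS _ = + 0

oneS : Series
oneS N = if N ≡ᵇ 0 then + 1 else + 0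

qpow : ℕ → Series
qpow a N = if N ≡ᵇ a then + 1 else + 0

_⊕_ : Series → Series → Series
(f ⊕ g) N = f N ℤ.+ g N

_⊙_ : ℤ → Series → Series
(z ⊙ f) N = z ℤ.* f N

_⊛_ : Series → Series → Series
(f ⊛ g) N = sumℤ< (suc N) (λ a → f a ℤ.* g (N ∸ a))

infixl 6 _⊕_
infixl 7 _⊛_ _⊙_

sumS : List Series → Series
sumS [] = zeroS
sumS (f ∷ fs) = f ⊕ sumS fs

-- Σ_{n ≥ 0} f n, for families where f n has order ≥ n
-- (coefficient N then only receives contributions from n ≤ N).
Σ∞₀ : (ℕ → Series) → Series
Σ∞₀ f N = sumℤ< (suc N) (λ n → f n N)

-- Σ_{n ≥ 1} f n, for families where f n has order ≥ n.
Σ∞₁ : (ℕ → Series) → Series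
Σ∞₁ f N = sumℤ< N (λ n′ → f (suc n′) N)

prodS≤ : ℕ → (ℕ → Series) → Series
prodS≤ zero f = oneS
prodS≤ (suc N) f = prodS≤ N f ⊛ f (suc N)

-- Π_{n ≥ 1} f n, for families with f n ≡ 1 mod q^n
-- (coefficient N is then determined by the factors n ≤ N).
Π∞₁ : (ℕ → Series) → Series
Π∞₁ f N = prodS≤ N f N

-- 1/(1 - q^a) = Σ_{j ≥ 0} q^{a j}   (used for a ≥ 1)
geom : ℕ → Series
geom a = Σ∞₀ (λ j → qpow (a ℕ.* j))

frac : ℕ → Series
frac a = qpow a ⊛ geom a

lambert : ℕ → Series
lambert a = Σ∞₁ (λ n → frac (a ℕ.* n))

Φ : ∀ {m} → (Fin m → ℕ) → Series
Φ r = Π∞₁ (λ n → if rFree r n then geom n else oneS)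

cSeries : ∀ {m} → (Fin m → ℕ) → Fin m → Series
cSeries r i n = + c r i n

sign : ℕ → ℤ
sign k = -[1+ 0 ] ℤ.^ k

card : ∀ {m} → Vec Bool m → ℕ
card S = countFin (λ l → lookup S l)

prodSub : ∀ {m} → (Fin m → ℕ) → Vec Bool m → ℕ
prodSub r S = prodFin (λ l → if lookup S l then r l else 1)

bracketA : ∀ {m} → (Fin m → ℕ) → Fin m → Series
bracketA {m} r i =
  lambert (r i) ⊕
  sumS (map (λ k′ → let k = suc k′ in
               sign k ⊙ sumS (map (λ S → lambert (r i ℕ.* prodSub r S))
                                  (filterᵇ (λ S → not (lookup S i) ∧ (card S ≡ᵇ k))
                                           (subsets m))))
            (upTo (m ∸ 1)))

bracketB : ∀ {m} → (Fin m → ℕ) → Fin m → Series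
bracketB r i = Σ∞₁ (λ n → if rFreeExcept r i n then frac (r i ℕ.* n) else zeroS)

module Submission where

-- Write every part-size s ≥ 1 uniquely as s = r^k · j with j
-- r-free (no r_l divides j); this needs the r_l pairwise coprime.  Then
-- c_{r_i,n} = Σ_{j free} Σ_k k_i W_{r^k j, n}.
--  (1) Partition counting: Σ_n W_{s,n} q^n = Φ_r(q) · Σ_{t free} q^{t s},
--      proved by building a partition one multiplicity at a time.
--  (2) Divisor counting: for y ≥ 1, the coefficient of q^y in
--      Σ_{j free} Σ_k k_i Σ_{t free} q^{t r^k j} equals
--      #{u ≥ 1 : r_i u ∣ y, r_l ∤ u for l ≠ i}, which is the coefficient
--      of q^y in the right bracket B = Σ_{u} q^{r_i u}/(1 - q^{r_i u}).
--      Combining (1) and (2) gives  Σ_n c_{r_i,n} q^n = Φ_r · B.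
--  (3) Inclusion-exclusion over subsets S ∌ i of {1..m} turns the
--      indicator of "r_l ∤ u for all l ≠ i" into Σ_S (-1)^|S| [Π_S r_l ∣ u],
--      which identifies B with the middle bracket A; hence Φ_r·A = Φ_r·B.

open import Defs
open import Data.Nat as ℕ using (ℕ; zero; suc; _≤_; _<_; z≤n; s≤s; _∸_; _≡ᵇ_; _≤ᵇ_; _^_; NonZero)
import Data.Nat.Properties as ℕP
open import Data.Nat.Divisibility using (_∣_; divides; _∣?_; ∣-trans; ∣-refl; ∣m⇒∣m*n; ∣m∣n⇒∣m+n; ∣⇒≤; *-monoʳ-∣; *-cancelˡ-∣)
open import Data.Nat.Coprimality using (Coprime; coprime-divisor; 1-coprimeTo) renaming (sym to coprime-sym)
open import Data.Nat.Induction using (<-rec)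
open import Data.Integer as ℤ using (ℤ; +_; -_; _-_; _+_; _*_)
import Data.Integer.Properties as ℤP
open import Data.Integer.Tactic.RingSolver using (solve-∀)
open import Data.Bool using (Bool; true; false; if_then_else_; _∧_; _∨_; not; T)
import Data.Bool.Properties as BoolP
open import Data.Fin using (Fin; zero; suc; toℕ; _≟_)
import Data.Fin.Properties as FinP
open import Data.Vec using (Vec; []; _∷_; lookup; replicate; tail)
import Data.Vec.Properties as VecP
open import Data.List using (List; []; _∷_; map; concatMap; filterᵇ; upTo; applyUpTo; _++_)
open import Data.Nat.ListAction using (sum)
open import Data.Product using (Σ; _×_; _,_; proj₁; proj₂)
open import Data.Sum using (inj₁; inj₂)
open import Data.Empty using (⊥-elim)
open import Function.Bundles using (mk⇔)
open import Data.Unit using (tt)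
open import Relation.Nullary using (¬_; yes; no; does)
open import Relation.Binary.PropositionalEquality
open ≡-Reasoning


𝟙 : Bool → ℤ
𝟙 b = if b then + 1 else + 0

𝟙-∧ : ∀ a b → 𝟙 (a ∧ b) ≡ 𝟙 a * 𝟙 b
𝟙-∧ true true = refl
𝟙-∧ true false = refl
𝟙-∧ false b = refl

𝟙-if : ∀ b (x : ℤ) → (if b then x else + 0) ≡ 𝟙 b * x
𝟙-if true x = sym (ℤP.*-identityˡ x)
𝟙-if false x = refl

≡ᵇ-true⇒≡ : ∀ m n → (m ≡ᵇ n) ≡ true → m ≡ n
≡ᵇ-true⇒≡ m n eq = ℕP.≡ᵇ⇒≡ m n (subst T (sym eq) tt)

≡ᵇ-refl : ∀ m → (m ≡ᵇ m) ≡ true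
≡ᵇ-refl zero = refl
≡ᵇ-refl (suc m) = ≡ᵇ-refl m

≢⇒≡ᵇ-false : ∀ m n → m ≢ n → (m ≡ᵇ n) ≡ false
≢⇒≡ᵇ-false m n ne with m ≡ᵇ n in eq
... | false = refl
... | true = ⊥-elim (ne (≡ᵇ-true⇒≡ m n eq))

≡ᵇ-sym : ∀ a b → (a ≡ᵇ b) ≡ (b ≡ᵇ a)
≡ᵇ-sym zero zero = refl
≡ᵇ-sym zero (suc b) = refl
≡ᵇ-sym (suc a) zero = refl
≡ᵇ-sym (suc a) (suc b) = ≡ᵇ-sym a b

≤⇒≤ᵇ-true : ∀ {m n} → m ≤ n → (m ≤ᵇ n) ≡ true
≤⇒≤ᵇ-true {m} {n} le with m ≤ᵇ n in eq
... | true = refl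
... | false = ⊥-elim (subst T eq (ℕP.≤⇒≤ᵇ le))

≰⇒≤ᵇ-false : ∀ {m n} → ¬ m ≤ n → (m ≤ᵇ n) ≡ false
≰⇒≤ᵇ-false {m} {n} nle with m ≤ᵇ n in eq
... | false = refl
... | true = ⊥-elim (nle (ℕP.≤ᵇ⇒≤ m n (subst T (sym eq) tt)))

<ᵇ-suc : ∀ a M → (a ℕ.<ᵇ suc M) ≡ (a ≤ᵇ M)
<ᵇ-suc a M with a ℕ.≤? M
... | yes le = trans (≤⇒≤ᵇ-true {suc a} {suc M} (s≤s le)) (sym (≤⇒≤ᵇ-true le))
... | no nle = trans (≰⇒≤ᵇ-false {suc a} {suc M} (λ p → nle (ℕP.≤-pred p))) (sym (≰⇒≤ᵇ-false nle))

𝟙-< : ∀ a b → a < b → 𝟙 (a ≡ᵇ b) ≡ + 0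
𝟙-< a b lt = cong 𝟙 (≢⇒≡ᵇ-false a b (λ e → ℕP.<-irrefl e lt))

𝟙-≡ᵇ-iff : ∀ {a b c d} → (a ≡ b → c ≡ d) → (c ≡ d → a ≡ b) → 𝟙 (a ≡ᵇ b) ≡ 𝟙 (c ≡ᵇ d)
𝟙-≡ᵇ-iff {a} {b} {c} {d} f g with a ℕ.≟ b | c ℕ.≟ d
... | yes p | yes q rewrite p | q = trans (cong 𝟙 (≡ᵇ-refl b)) (sym (cong 𝟙 (≡ᵇ-refl d)))
... | yes p | no q = ⊥-elim (q (f p))
... | no p | yes q = ⊥-elim (p (g q))
... | no p | no q = trans (cong 𝟙 (≢⇒≡ᵇ-false a b p)) (sym (cong 𝟙 (≢⇒≡ᵇ-false c d q)))

+-≡ᵇ : ∀ a W M → (a ℕ.+ W ≡ᵇ M) ≡ ((a ≤ᵇ M) ∧ (W ≡ᵇ M ∸ a))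
+-≡ᵇ a W M with a ℕ.≤? M
... | yes le rewrite ≤⇒≤ᵇ-true le with W ℕ.≟ M ∸ a
...   | yes refl rewrite ≡ᵇ-refl (M ∸ a) | ℕP.m+[n∸m]≡n le = ≡ᵇ-refl M
...   | no ne rewrite ≢⇒≡ᵇ-false W (M ∸ a) ne =
         ≢⇒≡ᵇ-false (a ℕ.+ W) M (λ e → ne (trans (sym (ℕP.m+n∸m≡n a W)) (cong (_∸ a) e)))
+-≡ᵇ a W M | no nle rewrite ≰⇒≤ᵇ-false nle =
         ≢⇒≡ᵇ-false (a ℕ.+ W) M (λ e → nle (subst (a ≤_) e (ℕP.m≤m+n a W)))

dv : ℕ → ℕ → Bool
dv a b = does (a ∣? b)

dv-true : ∀ {d j} → d ∣ j → dv d j ≡ true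
dv-true {d} {j} p with d ∣? j
... | yes _ = refl
... | no q = ⊥-elim (q p)

dv-false : ∀ {d j} → ¬ d ∣ j → dv d j ≡ false
dv-false {d} {j} p with d ∣? j
... | no _ = refl
... | yes q = ⊥-elim (p q)

dv-true⇒∣ : ∀ d j → dv d j ≡ true → d ∣ j
dv-true⇒∣ d j e with d ∣? j
... | yes p = p
dv-true⇒∣ d j () | no _

dv-false⇒∤ : ∀ d j → dv d j ≡ false → ¬ d ∣ j
dv-false⇒∤ d j e with d ∣? j
... | no p = p
dv-false⇒∤ d j () | yes _

𝟙-dv-iff : ∀ {a b c d} → (a ∣ b → c ∣ d) → (c ∣ d → a ∣ b) → 𝟙 (dv a b) ≡ 𝟙 (dv c d)
𝟙-dv-iff {a} {b} {c} {d} f g with a ∣? b | c ∣? d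
... | yes p | yes q = refl
... | yes p | no q = ⊥-elim (q (f p))
... | no p | yes q = ⊥-elim (p (g q))
... | no p | no q = refl

𝟙-dv-≤ᵇ : ∀ {a b c d} → (a ∣ b → c ≤ d) → (c ≤ d → a ∣ b) → 𝟙 (dv a b) ≡ 𝟙 (c ≤ᵇ d)
𝟙-dv-≤ᵇ {a} {b} {c} {d} f g with a ∣? b | c ℕ.≤? d
... | yes p | yes q = cong 𝟙 (sym (≤⇒≤ᵇ-true q))
... | yes p | no q = ⊥-elim (q (f p))
... | no p | yes q = ⊥-elim (p (g q))
... | no p | no q = cong 𝟙 (sym (≰⇒≤ᵇ-false q))

-- A divisor of y ≥ 1 is at most y, so numbers larger than y do not divide it.
𝟙-dv-big : ∀ a y → 1 ≤ y → y < a → 𝟙 (dv a y) ≡ + 0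
𝟙-dv-big a y y≥1 lt = cong 𝟙 (dv-false (λ p → ℕP.<-irrefl refl (ℕP.<-≤-trans lt (∣⇒≤ ⦃ ℕ.>-nonZero y≥1 ⦄ p))))

anyFin-false : ∀ {m} (f : Fin m → Bool) → anyFin f ≡ false → ∀ l → f l ≡ false
anyFin-false f e zero with f zero
anyFin-false f () zero | true
... | false = refl
anyFin-false f e (suc l) with f zero
anyFin-false f () (suc l) | true
... | false = anyFin-false (λ l → f (suc l)) e l

anyFin-true : ∀ {m} (f : Fin m → Bool) → anyFin f ≡ true → Σ (Fin m) (λ l → f l ≡ true)
anyFin-true {zero} f ()
anyFin-true {suc m} f e with f zero in eq
... | true = zero , eq
... | false = let (l , p) = anyFin-true (λ l → f (suc l)) e in suc l , p

allFin-ext : ∀ {k} {f g : Fin k → Bool} → (∀ p → f p ≡ g p) → allFin f ≡ allFin g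
allFin-ext {zero} h = refl
allFin-ext {suc k} h = cong₂ _∧_ (h zero) (allFin-ext (λ p → h (suc p)))

allFin-not : ∀ {m} (f : Fin m → Bool) → allFin (λ l → not (f l)) ≡ not (anyFin f)
allFin-not {zero} f = refl
allFin-not {suc m} f with f zero
... | true = refl
... | false = allFin-not (λ l → f (suc l))

rFree⇒∤ : ∀ {m} (r : Fin m → ℕ) j → rFree r j ≡ true → ∀ l → ¬ r l ∣ j
rFree⇒∤ r j e l with anyFin (λ l → does (r l ∣? j)) in eq
rFree⇒∤ r j () l | true
... | false = dv-false⇒∤ (r l) j (anyFin-false _ eq l)

¬rFree⇒∣ : ∀ {m} (r : Fin m → ℕ) j → rFree r j ≡ false → Σ (Fin _) (λ l → r l ∣ j)
¬rFree⇒∣ r j e with anyFin (λ l → does (r l ∣? j)) in eq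
¬rFree⇒∣ r j () | false
... | true = let (l , p) = anyFin-true _ eq in l , dv-true⇒∣ (r l) j p

Σ-cong : ∀ n {f g : ℕ → ℤ} → (∀ k → k < n → f k ≡ g k) → sumℤ< n f ≡ sumℤ< n g
Σ-cong zero h = refl
Σ-cong (suc n) h = cong₂ _+_ (Σ-cong n (λ k k<n → h k (ℕP.m<n⇒m<1+n k<n))) (h n ℕP.≤-refl)

Σ-ext : ∀ n {f g : ℕ → ℤ} → (∀ k → f k ≡ g k) → sumℤ< n f ≡ sumℤ< n g
Σ-ext n h = Σ-cong n (λ k _ → h k)

Σ-+ : ∀ n (f g : ℕ → ℤ) → sumℤ< n (λ k → f k + g k) ≡ sumℤ< n f + sumℤ< n g
Σ-+ zero f g = refl
Σ-+ (suc n) f g rewrite Σ-+ n f g = shuffle (sumℤ< n f) (sumℤ< n g) (f n) (g n)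
  where
  shuffle : ∀ a b c d → a + b + (c + d) ≡ a + c + (b + d)
  shuffle = solve-∀

Σ-*ˡ : ∀ n (a : ℤ) (f : ℕ → ℤ) → a * sumℤ< n f ≡ sumℤ< n (λ k → a * f k)
Σ-*ˡ zero a f = ℤP.*-zeroʳ a
Σ-*ˡ (suc n) a f rewrite sym (Σ-*ˡ n a f) = ℤP.*-distribˡ-+ a (sumℤ< n f) (f n)

Σ-*ʳ : ∀ n (a : ℤ) (f : ℕ → ℤ) → sumℤ< n f * a ≡ sumℤ< n (λ k → f k * a)
Σ-*ʳ n a f = trans (ℤP.*-comm (sumℤ< n f) a) (trans (Σ-*ˡ n a f) (Σ-ext n (λ k → ℤP.*-comm a (f k))))

Σ-zero : ∀ n {f : ℕ → ℤ} → (∀ k → k < n → f k ≡ + 0) → sumℤ< n f ≡ + 0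
Σ-zero zero h = refl
Σ-zero (suc n) h rewrite Σ-zero n (λ k k<n → h k (ℕP.m<n⇒m<1+n k<n)) | h n ℕP.≤-refl = refl

Σ-head : ∀ n (f : ℕ → ℤ) → sumℤ< (suc n) f ≡ f 0 + sumℤ< n (λ k → f (suc k))
Σ-head zero f = ℤP.+-comm (+ 0) (f 0)
Σ-head (suc n) f rewrite Σ-head n f = ℤP.+-assoc (f 0) _ _

Σ-split : ∀ n d (f : ℕ → ℤ) → sumℤ< (n ℕ.+ d) f ≡ sumℤ< n f + sumℤ< d (λ j → f (n ℕ.+ j))
Σ-split n zero f rewrite ℕP.+-identityʳ n = sym (ℤP.+-identityʳ _)
Σ-split n (suc d) f rewrite ℕP.+-suc n d | Σ-split n d f = ℤP.+-assoc (sumℤ< n f) _ _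

Σ-swap : ∀ n k (f : ℕ → ℕ → ℤ) →
  sumℤ< n (λ a → sumℤ< k (λ b → f a b)) ≡ sumℤ< k (λ b → sumℤ< n (λ a → f a b))
Σ-swap zero k f = sym (Σ-zero k (λ _ _ → refl))
Σ-swap (suc n) k f rewrite Σ-swap n k f = sym (Σ-+ k (λ b → sumℤ< n (λ a → f a b)) (λ b → f n b))

Σ-extend : ∀ n n′ (f : ℕ → ℤ) → n ≤ n′ → (∀ j → n ≤ j → j < n′ → f j ≡ + 0) →
  sumℤ< n′ f ≡ sumℤ< n f
Σ-extend n n′ f le h = begin
  sumℤ< n′ f                                     ≡⟨ cong (λ x → sumℤ< x f) (sym (ℕP.m+[n∸m]≡n le)) ⟩
  sumℤ< (n ℕ.+ (n′ ∸ n)) f                       ≡⟨ Σ-split n (n′ ∸ n) f ⟩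
  sumℤ< n f + sumℤ< (n′ ∸ n) (λ j → f (n ℕ.+ j)) ≡⟨ cong (λ x → sumℤ< n f + x) (Σ-zero (n′ ∸ n) tail-zero) ⟩
  sumℤ< n f + + 0                                ≡⟨ ℤP.+-identityʳ _ ⟩
  sumℤ< n f                                      ∎
  where
  tail-zero : ∀ j → j < n′ ∸ n → f (n ℕ.+ j) ≡ + 0
  tail-zero j j< = h (n ℕ.+ j) (ℕP.m≤m+n n j) (subst (n ℕ.+ j <_) (ℕP.m+[n∸m]≡n le) (ℕP.+-monoʳ-< n j<))

Σ-reverse : ∀ n (f : ℕ → ℤ) → sumℤ< n f ≡ sumℤ< n (λ k → f (n ∸ suc k))
Σ-reverse zero f = refl
Σ-reverse (suc n) f = begin
  sumℤ< n f + f n                                  ≡⟨ cong (_+ f n) (Σ-reverse n f) ⟩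
  sumℤ< n (λ k → f (n ∸ suc k)) + f n              ≡⟨ ℤP.+-comm _ (f n) ⟩
  f n + sumℤ< n (λ k → f (suc n ∸ suc (suc k)))    ≡⟨ sym (Σ-head n (λ k → f (suc n ∸ suc k))) ⟩
  sumℤ< (suc n) (λ k → f (suc n ∸ suc k))          ∎

Σ-triangle : ∀ n (F : ℕ → ℕ → ℤ) → sumℤ< n (λ a → sumℤ< (suc a) (λ b → F a b))
                                  ≡ sumℤ< n (λ b → sumℤ< (n ∸ b) (λ c → F (b ℕ.+ c) b))
Σ-triangle zero F = refl
Σ-triangle (suc n) F = begin
  sumℤ< n (λ a → sumℤ< (suc a) (λ b → F a b)) + sumℤ< (suc n) (F n)
    ≡⟨ cong (_+ sumℤ< (suc n) (F n)) (Σ-triangle n F) ⟩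
  sumℤ< n inner + sumℤ< (suc n) (F n)
    ≡⟨ cong (_+ sumℤ< (suc n) (F n)) (sym (trans (cong (λ x → sumℤ< n inner + x) inner-last) (ℤP.+-identityʳ (sumℤ< n inner)))) ⟩
  sumℤ< (suc n) inner + sumℤ< (suc n) (F n)
    ≡⟨ sym (Σ-+ (suc n) inner (F n)) ⟩
  sumℤ< (suc n) (λ b → inner b + F n b)
    ≡⟨ Σ-cong (suc n) extend-row ⟩
  sumℤ< (suc n) (λ b → sumℤ< (suc n ∸ b) (λ c → F (b ℕ.+ c) b)) ∎
  where
  inner : ℕ → ℤ
  inner b = sumℤ< (n ∸ b) (λ c → F (b ℕ.+ c) b)
  inner-last : inner n ≡ + 0
  inner-last rewrite ℕP.n∸n≡0 n = refl
  extend-row : ∀ b → b < suc n → inner b + F n b ≡ sumℤ< (suc n ∸ b) (λ c → F (b ℕ.+ c) b)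
  extend-row b b<sn rewrite ℕP.+-∸-assoc 1 (ℕP.≤-pred b<sn) | ℕP.m+[n∸m]≡n (ℕP.≤-pred b<sn) = refl

Σ-delta : ∀ n a (f : ℕ → ℤ) → a < n → sumℤ< n (λ k → if k ≡ᵇ a then f k else + 0) ≡ f a
Σ-delta (suc n) a f a<sn with ℕP.m≤n⇒m<n∨m≡n (ℕP.≤-pred a<sn)
... | inj₁ a<n = begin
  sumℤ< n (λ k → if k ≡ᵇ a then f k else + 0) + (if n ≡ᵇ a then f n else + 0)
    ≡⟨ cong₂ _+_ (Σ-delta n a f a<n) (cong (λ b → if b then f n else + 0) (≢⇒≡ᵇ-false n a (λ e → ℕP.<-irrefl (sym e) a<n))) ⟩
  f a + + 0 ≡⟨ ℤP.+-identityʳ _ ⟩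
  f a ∎
... | inj₂ refl = begin
  sumℤ< a (λ k → if k ≡ᵇ a then f k else + 0) + (if a ≡ᵇ a then f a else + 0)
    ≡⟨ cong₂ _+_ (Σ-zero a (λ k k<a → cong (λ b → if b then f k else + 0) (≢⇒≡ᵇ-false k a (λ e → ℕP.<-irrefl e k<a))))
                 (cong (λ b → if b then f a else + 0) (≡ᵇ-refl a)) ⟩
  + 0 + f a ≡⟨ ℤP.+-identityˡ _ ⟩
  f a ∎

Σ-pick : ∀ n c (F : ℕ → ℤ) → sumℤ< n (λ a → 𝟙 (a ≡ᵇ c) * F a) ≡ 𝟙 (c ℕ.<ᵇ n) * F c
Σ-pick n c F with c ℕ.<? n
... | yes lt rewrite ≤⇒≤ᵇ-true {suc c} {n} lt =
  trans (Σ-ext n (λ a → sym (𝟙-if (a ≡ᵇ c) (F a)))) (trans (Σ-delta n c F lt) (sym (ℤP.*-identityˡ (F c))))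
... | no nlt rewrite ≰⇒≤ᵇ-false {suc c} {n} nlt =
  Σ-zero n (λ a a<n → cong (λ z → 𝟙 z * F a) (≢⇒≡ᵇ-false a c (λ e → nlt (subst (_< n) e a<n))))

Σ-pick-suc : ∀ n X (h : ℕ → ℤ) → 1 ≤ X → (n < X → h X ≡ + 0) →
  sumℤ< n (λ z → 𝟙 (X ≡ᵇ suc z) * h (suc z)) ≡ h X
Σ-pick-suc n (suc X′) h _ out-of-range = begin
  sumℤ< n (λ z → 𝟙 (X′ ≡ᵇ z) * h (suc z)) ≡⟨ Σ-ext n (λ z → cong (λ b → 𝟙 b * h (suc z)) (≡ᵇ-sym X′ z)) ⟩
  sumℤ< n (λ z → 𝟙 (z ≡ᵇ X′) * h (suc z)) ≡⟨ Σ-pick n X′ (λ z → h (suc z)) ⟩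
  𝟙 (X′ ℕ.<ᵇ n) * h (suc X′)              ≡⟨ in-range ⟩
  h (suc X′)                              ∎
  where
  in-range : 𝟙 (X′ ℕ.<ᵇ n) * h (suc X′) ≡ h (suc X′)
  in-range with X′ ℕ.<? n
  ... | yes lt rewrite ≤⇒≤ᵇ-true {suc X′} {n} lt = ℤP.*-identityˡ _
  ... | no nlt rewrite ≰⇒≤ᵇ-false {suc X′} {n} nlt = sym (out-of-range (ℕP.≰⇒> nlt))

Σ-count : ∀ n κ → κ ≤ n → sumℤ< n (λ e → 𝟙 (suc e ≤ᵇ κ)) ≡ + κ
Σ-count n κ le = begin
  sumℤ< n (λ e → 𝟙 (suc e ≤ᵇ κ))
    ≡⟨ Σ-extend κ n _ le (λ j κ≤j _ → cong 𝟙 (≰⇒≤ᵇ-false (λ p → ℕP.<-irrefl refl (ℕP.<-≤-trans p κ≤j)))) ⟩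
  sumℤ< κ (λ e → 𝟙 (suc e ≤ᵇ κ)) ≡⟨ Σ-cong κ (λ e lt → cong 𝟙 (≤⇒≤ᵇ-true lt)) ⟩
  sumℤ< κ (λ _ → + 1)            ≡⟨ ones κ ⟩
  + κ                            ∎
  where
  ones : ∀ κ → sumℤ< κ (λ _ → + 1) ≡ + κ
  ones zero = refl
  ones (suc κ) rewrite ones κ = trans (ℤP.pos-+ κ 1) (cong +_ (ℕP.+-comm κ 1))

⊛-cong : ∀ {f f′ g g′ : Series} → f ≗ f′ → g ≗ g′ → f ⊛ g ≗ f′ ⊛ g′
⊛-cong p q N = Σ-ext (suc N) (λ a → cong₂ _*_ (p a) (q (N ∸ a)))

⊛-congˡ : ∀ {f f′ : Series} (g : Series) → f ≗ f′ → f ⊛ g ≗ f′ ⊛ g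
⊛-congˡ {f} {f′} g p = ⊛-cong {f} {f′} {g} {g} p (λ _ → refl)

⊛-congʳ : ∀ (f : Series) {g g′ : Series} → g ≗ g′ → f ⊛ g ≗ f ⊛ g′
⊛-congʳ f {g} {g′} q = ⊛-cong {f} {f} {g} {g′} (λ _ → refl) q

-- Commutativity, by reversing the order of summation.
⊛-comm : ∀ f g → f ⊛ g ≗ g ⊛ f
⊛-comm f g N = begin
  sumℤ< (suc N) (λ a → f a * g (N ∸ a))             ≡⟨ Σ-reverse (suc N) _ ⟩
  sumℤ< (suc N) (λ k → f (N ∸ k) * g (N ∸ (N ∸ k))) ≡⟨ Σ-cong (suc N) swap-factors ⟩
  sumℤ< (suc N) (λ k → g k * f (N ∸ k))             ∎
  where
  swap-factors : ∀ k → k < suc N → f (N ∸ k) * g (N ∸ (N ∸ k)) ≡ g k * f (N ∸ k)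
  swap-factors k k< = trans (cong (λ x → f (N ∸ k) * g x) (ℕP.m∸[m∸n]≡n (ℕP.≤-pred k<))) (ℤP.*-comm (f (N ∸ k)) (g k))

-- Associativity, by the triangle reindexing.
⊛-assoc : ∀ f g h → (f ⊛ g) ⊛ h ≗ f ⊛ (g ⊛ h)
⊛-assoc f g h N = begin
  sumℤ< (suc N) (λ a → sumℤ< (suc a) (λ b → f b * g (a ∸ b)) * h (N ∸ a))
    ≡⟨ Σ-ext (suc N) (λ a → Σ-*ʳ (suc a) (h (N ∸ a)) _) ⟩
  sumℤ< (suc N) (λ a → sumℤ< (suc a) (λ b → f b * g (a ∸ b) * h (N ∸ a)))
    ≡⟨ Σ-triangle (suc N) (λ a b → f b * g (a ∸ b) * h (N ∸ a)) ⟩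
  sumℤ< (suc N) (λ b → sumℤ< (suc N ∸ b) (λ c → f b * g (b ℕ.+ c ∸ b) * h (N ∸ (b ℕ.+ c))))
    ≡⟨ Σ-cong (suc N) row ⟩
  sumℤ< (suc N) (λ b → f b * sumℤ< (suc (N ∸ b)) (λ c → g c * h (N ∸ b ∸ c))) ∎
  where
  row : ∀ b → b < suc N → sumℤ< (suc N ∸ b) (λ c → f b * g (b ℕ.+ c ∸ b) * h (N ∸ (b ℕ.+ c)))
                          ≡ f b * sumℤ< (suc (N ∸ b)) (λ c → g c * h (N ∸ b ∸ c))
  row b b<sN rewrite ℕP.+-∸-assoc 1 (ℕP.≤-pred b<sN) = begin
    sumℤ< (suc (N ∸ b)) (λ c → f b * g (b ℕ.+ c ∸ b) * h (N ∸ (b ℕ.+ c)))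
      ≡⟨ Σ-ext (suc (N ∸ b)) (λ c → trans (ℤP.*-assoc (f b) _ _)
           (cong₂ (λ x y → f b * (g x * h y)) (ℕP.m+n∸m≡n b c) (sym (ℕP.∸-+-assoc N b c)))) ⟩
    sumℤ< (suc (N ∸ b)) (λ c → f b * (g c * h (N ∸ b ∸ c)))
      ≡⟨ sym (Σ-*ˡ (suc (N ∸ b)) (f b) _) ⟩
    f b * sumℤ< (suc (N ∸ b)) (λ c → g c * h (N ∸ b ∸ c)) ∎

⊛-distribˡ : ∀ f g h → f ⊛ (g ⊕ h) ≗ f ⊛ g ⊕ f ⊛ h
⊛-distribˡ f g h N = trans (Σ-ext (suc N) (λ a → ℤP.*-distribˡ-+ (f a) (g (N ∸ a)) (h (N ∸ a)))) (Σ-+ (suc N) _ _)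

⊛-identityˡ : ∀ f → oneS ⊛ f ≗ f
⊛-identityˡ f N = trans (Σ-head N _) (trans (cong₂ _+_ (ℤP.*-identityˡ (f N)) (Σ-zero N (λ k _ → refl))) (ℤP.+-identityʳ (f N)))

⊛-identityʳ : ∀ f → f ⊛ oneS ≗ f
⊛-identityʳ f N = trans (⊛-comm f oneS N) (⊛-identityˡ f N)

⊛-zeroʳ : ∀ f → f ⊛ zeroS ≗ zeroS
⊛-zeroʳ f N = Σ-zero (suc N) (λ k _ → ℤP.*-zeroʳ (f k))

ΣL : ∀ {A : Set} → List A → (A → ℤ) → ℤ
ΣL [] f = + 0
ΣL (x ∷ xs) f = f x + ΣL xs f

ΣL-ext : ∀ {A : Set} (L : List A) {f g : A → ℤ} → (∀ x → f x ≡ g x) → ΣL L f ≡ ΣL L g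
ΣL-ext [] h = refl
ΣL-ext (x ∷ L) h = cong₂ _+_ (h x) (ΣL-ext L h)

ΣL-++ : ∀ {A : Set} (L M : List A) (f : A → ℤ) → ΣL (L ++ M) f ≡ ΣL L f + ΣL M f
ΣL-++ [] M f = sym (ℤP.+-identityˡ _)
ΣL-++ (x ∷ L) M f rewrite ΣL-++ L M f = sym (ℤP.+-assoc (f x) _ _)

ΣL-concatMap : ∀ {A B : Set} (L : List A) (g : A → List B) (f : B → ℤ) →
  ΣL (concatMap g L) f ≡ ΣL L (λ x → ΣL (g x) f)
ΣL-concatMap [] g f = refl
ΣL-concatMap (x ∷ L) g f = trans (ΣL-++ (g x) (concatMap g L) f) (cong (λ z → ΣL (g x) f + z) (ΣL-concatMap L g f))

ΣL-map : ∀ {A B : Set} (L : List A) (g : A → B) (f : B → ℤ) → ΣL (map g L) f ≡ ΣL L (λ x → f (g x))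
ΣL-map [] g f = refl
ΣL-map (x ∷ L) g f = cong (λ z → f (g x) + z) (ΣL-map L g f)

ΣL-filter : ∀ {A : Set} (L : List A) (p : A → Bool) (f : A → ℤ) →
  ΣL (filterᵇ p L) f ≡ ΣL L (λ x → 𝟙 (p x) * f x)
ΣL-filter [] p f = refl
ΣL-filter (x ∷ L) p f with p x
... | true = cong₂ _+_ (sym (ℤP.*-identityˡ (f x))) (ΣL-filter L p f)
... | false = trans (ΣL-filter L p f) (sym (ℤP.+-identityˡ _))

ΣL-upTo : ∀ n (f : ℕ → ℤ) → ΣL (upTo n) f ≡ sumℤ< n f
ΣL-upTo n f = shifted n (λ k → k)
  where
  shifted : ∀ n (g : ℕ → ℕ) → ΣL (applyUpTo g n) f ≡ sumℤ< n (λ k → f (g k))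
  shifted zero g = refl
  shifted (suc n) g = trans (cong (λ z → f (g 0) + z) (shifted n (λ k → g (suc k)))) (sym (Σ-head n (λ k → f (g k))))

ΣL-+ : ∀ {A : Set} (L : List A) (f g : A → ℤ) → ΣL L (λ x → f x + g x) ≡ ΣL L f + ΣL L g
ΣL-+ [] f g = refl
ΣL-+ (x ∷ L) f g rewrite ΣL-+ L f g = shuffle (f x) (g x) (ΣL L f) (ΣL L g)
  where
  shuffle : ∀ a b c d → a + b + (c + d) ≡ a + c + (b + d)
  shuffle = solve-∀

ΣL-*ˡ : ∀ {A : Set} (L : List A) (a : ℤ) (f : A → ℤ) → a * ΣL L f ≡ ΣL L (λ x → a * f x)
ΣL-*ˡ [] a f = ℤP.*-zeroʳ a
ΣL-*ˡ (x ∷ L) a f rewrite sym (ΣL-*ˡ L a f) = ℤP.*-distribˡ-+ a (f x) (ΣL L f)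

ΣL-zero : ∀ {A : Set} (L : List A) → ΣL L (λ _ → + 0) ≡ + 0
ΣL-zero [] = refl
ΣL-zero (x ∷ L) = trans (ℤP.+-identityˡ _) (ΣL-zero L)

ΣL-Σ : ∀ {A : Set} (L : List A) n (f : A → ℕ → ℤ) →
  ΣL L (λ x → sumℤ< n (f x)) ≡ sumℤ< n (λ k → ΣL L (λ x → f x k))
ΣL-Σ [] n f = sym (Σ-zero n (λ _ _ → refl))
ΣL-Σ (x ∷ L) n f rewrite ΣL-Σ L n f = sym (Σ-+ n (f x) (λ k → ΣL L (λ x → f x k)))

sumS-map : ∀ {A : Set} (L : List A) (f : A → Series) y → sumS (map f L) y ≡ ΣL L (λ x → f x y)
sumS-map [] f y = refl
sumS-map (x ∷ L) f y = cong (λ z → f x y + z) (sumS-map L f y)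

+-sum : ∀ {A : Set} (L : List A) (f : A → ℕ) → + sum (map f L) ≡ ΣL L (λ x → + f x)
+-sum [] f = refl
+-sum (x ∷ L) f = trans (ℤP.pos-+ (f x) _) (cong (λ z → + f x + z) (+-sum L f))

+-sumℕ< : ∀ n (f : ℕ → ℕ) → + sumℕ< n f ≡ sumℤ< n (λ k → + f k)
+-sumℕ< zero f = refl
+-sumℕ< (suc n) f = trans (ℤP.pos-+ (sumℕ< n f) (f n)) (cong (λ z → z + + f n) (+-sumℕ< n f))

+-if : ∀ b (x y : ℕ) → + (if b then x else y) ≡ (if b then + x else + y)
+-if true x y = refl
+-if false x y = refl

vecsBounded-split : ∀ len b (F : Vec ℕ (suc len) → ℤ) →
  ΣL (vecsBounded (suc len) b) F ≡ sumℤ< (suc b) (λ x → ΣL (vecsBounded len b) (λ w → F (x ∷ w)))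
vecsBounded-split len b F = begin
  ΣL (concatMap (λ x → map (x ∷_) (vecsBounded len b)) (upTo (suc b))) F
    ≡⟨ ΣL-concatMap (upTo (suc b)) (λ x → map (x ∷_) (vecsBounded len b)) F ⟩
  ΣL (upTo (suc b)) (λ x → ΣL (map (x ∷_) (vecsBounded len b)) F)
    ≡⟨ ΣL-ext (upTo (suc b)) (λ x → ΣL-map (vecsBounded len b) (x ∷_) F) ⟩
  ΣL (upTo (suc b)) (λ x → ΣL (vecsBounded len b) (λ w → F (x ∷ w)))
    ≡⟨ ΣL-upTo (suc b) _ ⟩
  sumℤ< (suc b) (λ x → ΣL (vecsBounded len b) (λ w → F (x ∷ w))) ∎

subsets-split : ∀ m (F : Vec Bool (suc m) → ℤ) →
  ΣL (subsets (suc m)) F ≡ ΣL (subsets m) (λ S → F (true ∷ S)) + ΣL (subsets m) (λ S → F (false ∷ S))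
subsets-split m F = begin
  ΣL (subsets (suc m)) F
    ≡⟨ ΣL-concatMap (true ∷ false ∷ []) (λ x → map (x ∷_) (subsets m)) F ⟩
  ΣL (map (true ∷_) (subsets m)) F + (ΣL (map (false ∷_) (subsets m)) F + + 0)
    ≡⟨ cong₂ _+_ (ΣL-map (subsets m) (true ∷_) F) (trans (ℤP.+-identityʳ _) (ΣL-map (subsets m) (false ∷_) F)) ⟩
  ΣL (subsets m) (λ S → F (true ∷ S)) + ΣL (subsets m) (λ S → F (false ∷ S)) ∎

sumFinℤ : ∀ {k} → (Fin k → ℤ) → ℤ
sumFinℤ {zero} f = + 0
sumFinℤ {suc k} f = f zero + sumFinℤ (λ l → f (suc l))

sumFinℤ-ext : ∀ {k} {f g : Fin k → ℤ} → (∀ p → f p ≡ g p) → sumFinℤ f ≡ sumFinℤ g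
sumFinℤ-ext {zero} h = refl
sumFinℤ-ext {suc k} h = cong₂ _+_ (h zero) (sumFinℤ-ext (λ p → h (suc p)))

sumFin-ext : ∀ {k} {f g : Fin k → ℕ} → (∀ p → f p ≡ g p) → sumFin f ≡ sumFin g
sumFin-ext {zero} h = refl
sumFin-ext {suc k} h = cong₂ ℕ._+_ (h zero) (sumFin-ext (λ p → h (suc p)))

+-sumFin : ∀ {k} (f : Fin k → ℕ) → + sumFin f ≡ sumFinℤ (λ p → + f p)
+-sumFin {zero} f = refl
+-sumFin {suc k} f = trans (ℤP.pos-+ (f zero) _) (cong (λ z → + f zero + z) (+-sumFin (λ p → f (suc p))))

<-*-left : ∀ t x a → 1 ≤ t → a < x → a < t ℕ.* x
<-*-left (suc t) x a _ a<x = ℕP.<-≤-trans a<x (ℕP.m≤m+n x (t ℕ.* x))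

geom-small : ∀ t z → z < t → geom t z ≡ 𝟙 (z ≡ᵇ 0)
geom-small t z z<t = begin
  sumℤ< (suc z) (λ j → 𝟙 (z ≡ᵇ t ℕ.* j))                    ≡⟨ Σ-head z _ ⟩
  𝟙 (z ≡ᵇ t ℕ.* 0) + sumℤ< z (λ j → 𝟙 (z ≡ᵇ t ℕ.* suc j))
    ≡⟨ cong₂ _+_ (cong (λ u → 𝟙 (z ≡ᵇ u)) (ℕP.*-zeroʳ t))
         (Σ-zero z (λ j _ → 𝟙-< z (t ℕ.* suc j) (ℕP.<-≤-trans z<t (ℕP.m≤m*n t (suc j))))) ⟩
  𝟙 (z ≡ᵇ 0) + + 0                                          ≡⟨ ℤP.+-identityʳ _ ⟩
  𝟙 (z ≡ᵇ 0)                                                ∎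

-- The tail Σ_{x ≥ s} q^{t x} of the geometric series is q^{t s}/(1 - q^t),
-- read off coefficientwise.
geom-tail : ∀ t s a → 1 ≤ t →
  sumℤ< (suc a) (λ x → 𝟙 (a ≡ᵇ t ℕ.* x) * 𝟙 (s ≤ᵇ x)) ≡ 𝟙 (t ℕ.* s ≤ᵇ a) * geom t (a ∸ t ℕ.* s)
geom-tail t s a t≥1 with t ℕ.* s ℕ.≤? a
... | no nle rewrite ≰⇒≤ᵇ-false nle = Σ-zero (suc a) below
  where
  below : ∀ x → x < suc a → 𝟙 (a ≡ᵇ t ℕ.* x) * 𝟙 (s ≤ᵇ x) ≡ + 0
  below x _ with s ℕ.≤? x
  ... | yes s≤x = cong (λ z → 𝟙 z * 𝟙 (s ≤ᵇ x))
                    (≢⇒≡ᵇ-false a (t ℕ.* x) (λ e → nle (subst (t ℕ.* s ≤_) (sym e) (ℕP.*-monoʳ-≤ t s≤x))))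
  ... | no s≰x rewrite ≰⇒≤ᵇ-false s≰x = ℤP.*-zeroʳ (𝟙 (a ≡ᵇ t ℕ.* x))
... | yes le rewrite ≤⇒≤ᵇ-true le = begin
  sumℤ< (suc a) term
    ≡⟨ cong (λ z → sumℤ< z term) (sym (ℕP.m+[n∸m]≡n s≤1+a)) ⟩
  sumℤ< (s ℕ.+ (suc a ∸ s)) term
    ≡⟨ Σ-split s (suc a ∸ s) term ⟩
  sumℤ< s term + sumℤ< (suc a ∸ s) (λ j → term (s ℕ.+ j))
    ≡⟨ cong₂ _+_ (Σ-zero s (λ x x<s → trans (cong (λ z → 𝟙 (a ≡ᵇ t ℕ.* x) * 𝟙 z) (≰⇒≤ᵇ-false (ℕP.<⇒≱ x<s)))
                                             (ℤP.*-zeroʳ (𝟙 (a ≡ᵇ t ℕ.* x)))))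
                 (Σ-ext (suc a ∸ s) (λ j → trans (cong (λ z → 𝟙 (a ≡ᵇ t ℕ.* (s ℕ.+ j)) * 𝟙 z) (≤⇒≤ᵇ-true (ℕP.m≤m+n s j)))
                                                  (ℤP.*-identityʳ _))) ⟩
  + 0 + sumℤ< (suc a ∸ s) (λ j → 𝟙 (a ≡ᵇ t ℕ.* (s ℕ.+ j)))
    ≡⟨ trans (ℤP.+-identityˡ _) (Σ-ext (suc a ∸ s) shift) ⟩
  sumℤ< (suc a ∸ s) (λ j → 𝟙 (a ∸ ts ≡ᵇ t ℕ.* j))
    ≡⟨ Σ-extend (suc (a ∸ ts)) (suc a ∸ s) _ range (λ j lt _ → 𝟙-< (a ∸ ts) (t ℕ.* j) (<-*-left t j (a ∸ ts) t≥1 lt)) ⟩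
  geom t (a ∸ ts)
    ≡⟨ sym (ℤP.*-identityˡ _) ⟩
  + 1 * geom t (a ∸ ts) ∎
  where
  ts : ℕ
  ts = t ℕ.* s
  term : ℕ → ℤ
  term x = 𝟙 (a ≡ᵇ t ℕ.* x) * 𝟙 (s ≤ᵇ x)
  s≤ts : s ≤ ts
  s≤ts = subst (_≤ ts) (ℕP.*-identityˡ s) (ℕP.*-monoˡ-≤ s t≥1)
  s≤1+a : s ≤ suc a
  s≤1+a = ℕP.m≤n⇒m≤1+n (ℕP.≤-trans s≤ts le)
  range : suc (a ∸ ts) ≤ suc a ∸ s
  range = subst (suc (a ∸ ts) ≤_) (sym (ℕP.+-∸-assoc 1 (ℕP.≤-trans s≤ts le))) (s≤s (ℕP.∸-monoʳ-≤ a s≤ts))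
  shift : ∀ j → 𝟙 (a ≡ᵇ t ℕ.* (s ℕ.+ j)) ≡ 𝟙 (a ∸ ts ≡ᵇ t ℕ.* j)
  shift j = cong 𝟙 (begin
    (a ≡ᵇ t ℕ.* (s ℕ.+ j))            ≡⟨ ≡ᵇ-sym a _ ⟩
    (t ℕ.* (s ℕ.+ j) ≡ᵇ a)            ≡⟨ cong (_≡ᵇ a) (ℕP.*-distribˡ-+ t s j) ⟩
    (ts ℕ.+ t ℕ.* j ≡ᵇ a)             ≡⟨ +-≡ᵇ ts (t ℕ.* j) a ⟩
    ((ts ≤ᵇ a) ∧ (t ℕ.* j ≡ᵇ a ∸ ts)) ≡⟨ cong (_∧ (t ℕ.* j ≡ᵇ a ∸ ts)) (≤⇒≤ᵇ-true le) ⟩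
    (t ℕ.* j ≡ᵇ a ∸ ts)               ≡⟨ ≡ᵇ-sym (t ℕ.* j) _ ⟩
    (a ∸ ts ≡ᵇ t ℕ.* j)               ∎)

-- Step (1): partition counting.  A partition with parts o+1, …, o+len is
-- a multiplicity vector w (w_p = multiplicity of o+1+p); it is admissible
-- when every part actually used is r-free.  Counting admissible vectors by
-- weight gives the product R o len of the factors A t = 1/(1-q^t) (t free)
-- or 1 (t not free); counting them with a mark Σ_p G(w_p) gives the series
-- R′ o len, which for G x = [x ≥ s] is R o len · Σ_{t free} q^{t s}.

module PartitionCounting {m} (r : Fin m → ℕ) where

  weightFrom : ∀ {len} → ℕ → Vec ℕ len → ℕ
  weightFrom o w = sumFin (λ p → (o ℕ.+ suc (toℕ p)) ℕ.* lookup w p)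

  weightFrom-cons : ∀ {len} o x (w : Vec ℕ len) → weightFrom o (x ∷ w) ≡ suc o ℕ.* x ℕ.+ weightFrom (suc o) w
  weightFrom-cons o x w = cong₂ ℕ._+_ (cong (ℕ._* x) (ℕP.+-comm o 1))
                            (sumFin-ext (λ p → cong (ℕ._* lookup w p) (ℕP.+-suc o (suc (toℕ p)))))

  allowed : ℕ → ℕ → Bool
  allowed t x = (x ≡ᵇ 0) ∨ rFree r t

  allowedFrom : ∀ {len} → ℕ → Vec ℕ len → Bool
  allowedFrom o w = allFin (λ p → (lookup w p ≡ᵇ 0) ∨ rFree r (o ℕ.+ suc (toℕ p)))

  allowedFrom-cons : ∀ {len} o x (w : Vec ℕ len) → allowedFrom o (x ∷ w) ≡ allowed (suc o) x ∧ allowedFrom (suc o) w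
  allowedFrom-cons o x w = cong₂ _∧_ (cong (λ z → (x ≡ᵇ 0) ∨ rFree r z) (ℕP.+-comm o 1))
                             (allFin-ext (λ p → cong (λ z → (lookup w p ≡ᵇ 0) ∨ rFree r z) (ℕP.+-suc o (suc (toℕ p)))))

  admissible : ∀ {len} → ℕ → ℕ → Vec ℕ len → Bool
  admissible o M w = (weightFrom o w ≡ᵇ M) ∧ allowedFrom o w

  A : ℕ → Series
  A t = if rFree r t then geom t else oneS

  K : ℕ → (ℕ → ℤ) → Series
  K t g a = sumℤ< (suc a) (λ x → 𝟙 (a ≡ᵇ t ℕ.* x) * (𝟙 (allowed t x) * g x))

  R : ℕ → ℕ → Series
  R o zero = oneS
  R o (suc len) = A (suc o) ⊛ R (suc o) len

  A≗K : ∀ t → A t ≗ K t (λ _ → + 1)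
  A≗K t a with rFree r t
  ... | true = Σ-ext (suc a) (λ x → sym (trans (cong (λ z → 𝟙 (a ≡ᵇ t ℕ.* x) * (𝟙 z * + 1)) (BoolP.∨-zeroʳ (x ≡ᵇ 0)))
                                               (ℤP.*-identityʳ _)))
  ... | false = sym (begin
    sumℤ< (suc a) (λ x → 𝟙 (a ≡ᵇ t ℕ.* x) * (𝟙 ((x ≡ᵇ 0) ∨ false) * + 1))
      ≡⟨ Σ-head a _ ⟩
    𝟙 (a ≡ᵇ t ℕ.* 0) * + 1 + sumℤ< a (λ x → 𝟙 (a ≡ᵇ t ℕ.* suc x) * + 0)
      ≡⟨ cong₂ _+_ (cong (λ u → 𝟙 (a ≡ᵇ u) * + 1) (ℕP.*-zeroʳ t)) (Σ-zero a (λ x _ → ℤP.*-zeroʳ (𝟙 (a ≡ᵇ t ℕ.* suc x)))) ⟩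
    𝟙 (a ≡ᵇ 0) * + 1 + + 0
      ≡⟨ trans (ℤP.+-identityʳ _) (ℤP.*-identityʳ _) ⟩
    oneS a ∎)

  -- Choosing the multiplicity x of part t first: convolution with K t g.
  K-⊛ : ∀ t (g : ℕ → ℤ) (H : Series) b M → 1 ≤ t → M ≤ b →
    sumℤ< (suc b) (λ x → 𝟙 (t ℕ.* x ≤ᵇ M) * (𝟙 (allowed t x) * g x) * H (M ∸ t ℕ.* x)) ≡ (K t g ⊛ H) M
  K-⊛ t g H b M t≥1 M≤b = sym (begin
    sumℤ< (suc M) (λ a → sumℤ< (suc a) (λ x → term a x) * H (M ∸ a))
      ≡⟨ Σ-cong (suc M) (λ a a<sM → cong (_* H (M ∸ a))
           (sym (Σ-extend (suc a) (suc b) (term a) (s≤s (ℕP.≤-trans (ℕP.≤-pred a<sM) M≤b))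
              (λ x a<x _ → cong (_* (𝟙 (allowed t x) * g x)) (𝟙-< a (t ℕ.* x) (<-*-left t x a t≥1 a<x)))))) ⟩
    sumℤ< (suc M) (λ a → sumℤ< (suc b) (λ x → term a x) * H (M ∸ a))
      ≡⟨ Σ-ext (suc M) (λ a → Σ-*ʳ (suc b) (H (M ∸ a)) _) ⟩
    sumℤ< (suc M) (λ a → sumℤ< (suc b) (λ x → term a x * H (M ∸ a)))
      ≡⟨ Σ-swap (suc M) (suc b) _ ⟩
    sumℤ< (suc b) (λ x → sumℤ< (suc M) (λ a → term a x * H (M ∸ a)))
      ≡⟨ Σ-ext (suc b) (λ x → trans (Σ-ext (suc M) (λ a → ℤP.*-assoc (𝟙 (a ≡ᵇ t ℕ.* x)) _ _))
            (Σ-pick (suc M) (t ℕ.* x) (λ a → (𝟙 (allowed t x) * g x) * H (M ∸ a)))) ⟩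
    sumℤ< (suc b) (λ x → 𝟙 (t ℕ.* x ℕ.<ᵇ suc M) * ((𝟙 (allowed t x) * g x) * H (M ∸ t ℕ.* x)))
      ≡⟨ Σ-ext (suc b) (λ x → trans (sym (ℤP.*-assoc (𝟙 (t ℕ.* x ℕ.<ᵇ suc M)) _ _))
            (cong (λ z → 𝟙 z * (𝟙 (allowed t x) * g x) * H (M ∸ t ℕ.* x)) (<ᵇ-suc (t ℕ.* x) M))) ⟩
    sumℤ< (suc b) (λ x → 𝟙 (t ℕ.* x ≤ᵇ M) * (𝟙 (allowed t x) * g x) * H (M ∸ t ℕ.* x)) ∎)
    where
    term : ℕ → ℕ → ℤ
    term a x = 𝟙 (a ≡ᵇ t ℕ.* x) * (𝟙 (allowed t x) * g x)

  𝟙-admissible-cons : ∀ {len} o x (w : Vec ℕ len) M →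
    𝟙 (admissible o M (x ∷ w))
      ≡ 𝟙 (suc o ℕ.* x ≤ᵇ M) * (𝟙 (allowed (suc o) x) * + 1) * 𝟙 (admissible (suc o) (M ∸ suc o ℕ.* x) w)
  𝟙-admissible-cons o x w M
    rewrite weightFrom-cons o x w | allowedFrom-cons o x w | +-≡ᵇ (suc o ℕ.* x) (weightFrom (suc o) w) M =
    regroup (suc o ℕ.* x ≤ᵇ M) (weightFrom (suc o) w ≡ᵇ M ∸ suc o ℕ.* x) (allowed (suc o) x) (allowedFrom (suc o) w)
    where
    regroup : ∀ a b c d → 𝟙 ((a ∧ b) ∧ (c ∧ d)) ≡ 𝟙 a * (𝟙 c * + 1) * 𝟙 (b ∧ d)
    regroup a b c d = begin
      𝟙 ((a ∧ b) ∧ (c ∧ d))       ≡⟨ trans (𝟙-∧ (a ∧ b) (c ∧ d)) (cong₂ _*_ (𝟙-∧ a b) (𝟙-∧ c d)) ⟩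
      𝟙 a * 𝟙 b * (𝟙 c * 𝟙 d)     ≡⟨ ring (𝟙 a) (𝟙 b) (𝟙 c) (𝟙 d) ⟩
      𝟙 a * (𝟙 c * + 1) * (𝟙 b * 𝟙 d) ≡⟨ cong (𝟙 a * (𝟙 c * + 1) *_) (sym (𝟙-∧ b d)) ⟩
      𝟙 a * (𝟙 c * + 1) * 𝟙 (b ∧ d) ∎
      where
      ring : ∀ a b c d → a * b * (c * d) ≡ a * (c * + 1) * (b * d)
      ring = solve-∀

  count-admissible : ∀ o len b M → M ≤ b → ΣL (vecsBounded len b) (λ w → 𝟙 (admissible o M w)) ≡ R o len M
  count-admissible o zero b zero _ = refl
  count-admissible o zero b (suc M) _ = refl
  count-admissible o (suc len) b M M≤b = begin
    ΣL (vecsBounded (suc len) b) (λ w → 𝟙 (admissible o M w))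
      ≡⟨ vecsBounded-split len b _ ⟩
    sumℤ< (suc b) (λ x → ΣL (vecsBounded len b) (λ w → 𝟙 (admissible o M (x ∷ w))))
      ≡⟨ Σ-ext (suc b) (λ x → trans (ΣL-ext (vecsBounded len b) (λ w → 𝟙-admissible-cons o x w M))
           (trans (sym (ΣL-*ˡ (vecsBounded len b) (coeff x) (λ w → 𝟙 (admissible t (M ∸ t ℕ.* x) w))))
                  (cong (coeff x *_) (count-admissible t len b (M ∸ t ℕ.* x) (ℕP.≤-trans (ℕP.m∸n≤m M (t ℕ.* x)) M≤b))))) ⟩
    sumℤ< (suc b) (λ x → coeff x * R t len (M ∸ t ℕ.* x))
      ≡⟨ K-⊛ t (λ _ → + 1) (R t len) b M (s≤s z≤n) M≤b ⟩
    (K t (λ _ → + 1) ⊛ R t len) M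
      ≡⟨ ⊛-congˡ (R t len) (λ a → sym (A≗K t a)) M ⟩
    R o (suc len) M ∎
    where
    t : ℕ
    t = suc o
    coeff : ℕ → ℤ
    coeff x = 𝟙 (t ℕ.* x ≤ᵇ M) * (𝟙 (allowed t x) * + 1)

  module Marked (G : ℕ → ℤ) where

    mark : ∀ {len} → Vec ℕ len → ℤ
    mark w = sumFinℤ (λ p → G (lookup w p))

    -- The marked product: the mark sits on exactly one of the factors.
    R′ : ℕ → ℕ → Series
    R′ o zero = zeroS
    R′ o (suc len) = K (suc o) G ⊛ R (suc o) len ⊕ A (suc o) ⊛ R′ (suc o) len

    count-marked : ∀ o len b M → M ≤ b →
      ΣL (vecsBounded len b) (λ w → 𝟙 (admissible o M w) * mark w) ≡ R′ o len M
    count-marked o zero b zero _ = refl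
    count-marked o zero b (suc M) _ = refl
    count-marked o (suc len) b M M≤b = begin
      ΣL (vecsBounded (suc len) b) (λ w → 𝟙 (admissible o M w) * mark w)
        ≡⟨ vecsBounded-split len b _ ⟩
      sumℤ< (suc b) (λ x → ΣL (vecsBounded len b) (λ w → 𝟙 (admissible o M (x ∷ w)) * (G x + mark w)))
        ≡⟨ Σ-ext (suc b) split-mark ⟩
      sumℤ< (suc b) (λ x → 𝟙 (t ℕ.* x ≤ᵇ M) * (𝟙 (allowed t x) * G x) * R t len (M ∸ t ℕ.* x)
                         + 𝟙 (t ℕ.* x ≤ᵇ M) * (𝟙 (allowed t x) * + 1) * R′ t len (M ∸ t ℕ.* x))
        ≡⟨ Σ-+ (suc b) _ _ ⟩
      _ ≡⟨ cong₂ _+_ (K-⊛ t G (R t len) b M (s≤s z≤n) M≤b)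
                     (trans (K-⊛ t (λ _ → + 1) (R′ t len) b M (s≤s z≤n) M≤b)
                            (⊛-congˡ (R′ t len) (λ a → sym (A≗K t a)) M)) ⟩
      R′ o (suc len) M ∎
      where
      t : ℕ
      t = suc o
      M′ : ℕ → ℕ
      M′ x = M ∸ t ℕ.* x
      M′≤b : ∀ x → M′ x ≤ b
      M′≤b x = ℕP.≤-trans (ℕP.m∸n≤m M (t ℕ.* x)) M≤b
      split-mark : ∀ x → ΣL (vecsBounded len b) (λ w → 𝟙 (admissible o M (x ∷ w)) * (G x + mark w))
        ≡ 𝟙 (t ℕ.* x ≤ᵇ M) * (𝟙 (allowed t x) * G x) * R t len (M′ x)
          + 𝟙 (t ℕ.* x ≤ᵇ M) * (𝟙 (allowed t x) * + 1) * R′ t len (M′ x)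
      split-mark x = begin
        ΣL (vecsBounded len b) (λ w → 𝟙 (admissible o M (x ∷ w)) * (G x + mark w))
          ≡⟨ ΣL-ext (vecsBounded len b) (λ w → trans (cong (_* (G x + mark w)) (𝟙-admissible-cons o x w M))
               (ring (𝟙 (t ℕ.* x ≤ᵇ M)) (𝟙 (allowed t x)) (G x) (𝟙 (admissible t (M′ x) w)) (mark w))) ⟩
        ΣL (vecsBounded len b) (λ w → cG * 𝟙 (admissible t (M′ x) w) + c1 * (𝟙 (admissible t (M′ x) w) * mark w))
          ≡⟨ ΣL-+ (vecsBounded len b) _ _ ⟩
        ΣL (vecsBounded len b) (λ w → cG * 𝟙 (admissible t (M′ x) w))
          + ΣL (vecsBounded len b) (λ w → c1 * (𝟙 (admissible t (M′ x) w) * mark w))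
          ≡⟨ cong₂ _+_ (trans (sym (ΣL-*ˡ (vecsBounded len b) cG _)) (cong (cG *_) (count-admissible t len b (M′ x) (M′≤b x))))
                       (trans (sym (ΣL-*ˡ (vecsBounded len b) c1 _)) (cong (c1 *_) (count-marked t len b (M′ x) (M′≤b x)))) ⟩
        cG * R t len (M′ x) + c1 * R′ t len (M′ x) ∎
        where
        cG c1 : ℤ
        cG = 𝟙 (t ℕ.* x ≤ᵇ M) * (𝟙 (allowed t x) * G x)
        c1 = 𝟙 (t ℕ.* x ≤ᵇ M) * (𝟙 (allowed t x) * + 1)
        ring : ∀ p o g I mk → p * (o * + 1) * I * (g + mk) ≡ p * (o * g) * I + p * (o * + 1) * (I * mk)
        ring = solve-∀

  -- A t starts 1 + O(q^t), so factors A (K+1), A (K+2), … do not affect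
  -- coefficients up to K; hence R 0 n agrees with Φ_r below degree n.
  A-small : ∀ t z → z < t → A t z ≡ 𝟙 (z ≡ᵇ 0)
  A-small t z z<t with rFree r t
  ... | true = geom-small t z z<t
  ... | false = refl

  ⊛-A-beyond : ∀ (g : Series) K y → y ≤ K → (g ⊛ A (suc K)) y ≡ g y
  ⊛-A-beyond g K y y≤K = begin
    sumℤ< (suc y) (λ a → g a * A (suc K) (y ∸ a))
      ≡⟨ Σ-cong (suc y) (λ a a<sy → trans (cong (g a *_) (A-small (suc K) (y ∸ a) (s≤s (ℕP.≤-trans (ℕP.m∸n≤m y a) y≤K))))
            (trans (cong (λ z → g a * 𝟙 z) (difference-zero a (ℕP.≤-pred a<sy))) (ℤP.*-comm (g a) _))) ⟩
    sumℤ< (suc y) (λ a → 𝟙 (a ≡ᵇ y) * g a) ≡⟨ Σ-pick (suc y) y g ⟩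
    𝟙 (y ℕ.<ᵇ suc y) * g y                 ≡⟨ cong (λ z → 𝟙 z * g y) (trans (<ᵇ-suc y y) (≤⇒≤ᵇ-true (ℕP.≤-refl {y}))) ⟩
    + 1 * g y                              ≡⟨ ℤP.*-identityˡ (g y) ⟩
    g y                                    ∎
    where
    difference-zero : ∀ a → a ≤ y → (y ∸ a ≡ᵇ 0) ≡ (a ≡ᵇ y)
    difference-zero a a≤y with a ℕ.≟ y
    ... | yes refl rewrite ℕP.n∸n≡0 a = sym (≡ᵇ-refl a)
    ... | no ne = trans (≢⇒≡ᵇ-false (y ∸ a) 0 (λ e → ne (ℕP.≤-antisym a≤y (ℕP.m∸n≡0⇒m≤n e)))) (sym (≢⇒≡ᵇ-false a y ne))

  prodS≤-stable : ∀ K d y → y ≤ K → prodS≤ (K ℕ.+ d) A y ≡ prodS≤ K A y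
  prodS≤-stable K zero y le rewrite ℕP.+-identityʳ K = refl
  prodS≤-stable K (suc d) y le rewrite ℕP.+-suc K d =
    trans (⊛-A-beyond (prodS≤ (K ℕ.+ d) A) (K ℕ.+ d) y (ℕP.≤-trans le (ℕP.m≤m+n K d))) (prodS≤-stable K d y le)

  prodS≤-R : ∀ K len → prodS≤ K A ⊛ R K len ≗ prodS≤ (K ℕ.+ len) A
  prodS≤-R K zero N rewrite ℕP.+-identityʳ K = ⊛-identityʳ (prodS≤ K A) N
  prodS≤-R K (suc len) N rewrite ℕP.+-suc K len = begin
    (prodS≤ K A ⊛ (A (suc K) ⊛ R (suc K) len)) N ≡⟨ sym (⊛-assoc (prodS≤ K A) (A (suc K)) (R (suc K) len) N) ⟩
    (prodS≤ (suc K) A ⊛ R (suc K) len) N         ≡⟨ prodS≤-R (suc K) len N ⟩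
    prodS≤ (suc K ℕ.+ len) A N                   ∎

  R-Φ : ∀ n a → a ≤ n → R 0 n a ≡ Φ r a
  R-Φ n a le = begin
    R 0 n a                    ≡⟨ sym (⊛-identityˡ (R 0 n) a) ⟩
    (oneS ⊛ R 0 n) a           ≡⟨ prodS≤-R 0 n a ⟩
    prodS≤ n A a               ≡⟨ cong (λ z → prodS≤ z A a) (sym (ℕP.m+[n∸m]≡n le)) ⟩
    prodS≤ (a ℕ.+ (n ∸ a)) A a ≡⟨ prodS≤-stable a (n ∸ a) a ℕP.≤-refl ⟩
    prodS≤ a A a               ∎

  freeMultiples : ℕ → ℕ → ℕ → ℤ
  freeMultiples n s y = sumℤ< n (λ p → 𝟙 (rFree r (suc p)) * 𝟙 (y ≡ᵇ suc p ℕ.* s))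

  module Threshold (s : ℕ) (s≥1 : 1 ≤ s) where

    atLeast : ℕ → ℤ
    atLeast x = 𝟙 (s ≤ᵇ x)

    open Marked atLeast

    Δ : ℕ → Series
    Δ t = if rFree r t then qpow (t ℕ.* s) else zeroS

    D : ℕ → ℕ → Series
    D o zero = zeroS
    D o (suc len) = Δ (suc o) ⊕ D (suc o) len

    -- For free t: Σ_{x ≥ s} q^{t x} = q^{t s}/(1 - q^t).
    K≗A⊛Δ : ∀ t → 1 ≤ t → K t atLeast ≗ A t ⊛ Δ t
    K≗A⊛Δ t t≥1 a with rFree r t
    ... | true = begin
      sumℤ< (suc a) (λ x → 𝟙 (a ≡ᵇ t ℕ.* x) * (𝟙 ((x ≡ᵇ 0) ∨ true) * atLeast x))
        ≡⟨ Σ-ext (suc a) (λ x → cong (λ z → 𝟙 (a ≡ᵇ t ℕ.* x) * (𝟙 z * atLeast x)) (BoolP.∨-zeroʳ (x ≡ᵇ 0))) ⟩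
      sumℤ< (suc a) (λ x → 𝟙 (a ≡ᵇ t ℕ.* x) * (+ 1 * atLeast x))
        ≡⟨ Σ-ext (suc a) (λ x → cong (𝟙 (a ≡ᵇ t ℕ.* x) *_) (ℤP.*-identityˡ (atLeast x))) ⟩
      sumℤ< (suc a) (λ x → 𝟙 (a ≡ᵇ t ℕ.* x) * atLeast x)
        ≡⟨ geom-tail t s a t≥1 ⟩
      𝟙 (t ℕ.* s ≤ᵇ a) * geom t (a ∸ t ℕ.* s)
        ≡⟨ cong (λ z → 𝟙 z * geom t (a ∸ t ℕ.* s)) (sym (<ᵇ-suc (t ℕ.* s) a)) ⟩
      𝟙 (t ℕ.* s ℕ.<ᵇ suc a) * geom t (a ∸ t ℕ.* s)
        ≡⟨ sym (Σ-pick (suc a) (t ℕ.* s) (λ a′ → geom t (a ∸ a′))) ⟩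
      (qpow (t ℕ.* s) ⊛ geom t) a
        ≡⟨ ⊛-comm (qpow (t ℕ.* s)) (geom t) a ⟩
      (geom t ⊛ qpow (t ℕ.* s)) a ∎
    ... | false = trans (Σ-zero (suc a) never) (sym (⊛-zeroʳ oneS a))
      where
      never : ∀ x → x < suc a → 𝟙 (a ≡ᵇ t ℕ.* x) * (𝟙 ((x ≡ᵇ 0) ∨ false) * atLeast x) ≡ + 0
      never zero _ rewrite ≰⇒≤ᵇ-false {s} {0} (λ p → ℕP.<-irrefl refl (ℕP.<-≤-trans s≥1 p)) = ℤP.*-zeroʳ (𝟙 (a ≡ᵇ t ℕ.* 0))
      never (suc x) _ = ℤP.*-zeroʳ (𝟙 (a ≡ᵇ t ℕ.* suc x))

    R′≗R⊛D : ∀ o len → R′ o len ≗ R o len ⊛ D o len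
    R′≗R⊛D o zero N = sym (⊛-zeroʳ oneS N)
    R′≗R⊛D o (suc len) N = begin
      (K t atLeast ⊛ R₁) N + (A t ⊛ R′ t len) N
        ≡⟨ cong₂ _+_ marked-here marked-later ⟩
      ((A t ⊛ R₁) ⊛ Δ t) N + ((A t ⊛ R₁) ⊛ D₁) N
        ≡⟨ sym (⊛-distribˡ (A t ⊛ R₁) (Δ t) D₁ N) ⟩
      ((A t ⊛ R₁) ⊛ (Δ t ⊕ D₁)) N ∎
      where
      t : ℕ
      t = suc o
      R₁ D₁ : Series
      R₁ = R t len
      D₁ = D t len
      marked-here : (K t atLeast ⊛ R₁) N ≡ ((A t ⊛ R₁) ⊛ Δ t) N
      marked-here = begin
        (K t atLeast ⊛ R₁) N  ≡⟨ ⊛-congˡ R₁ (K≗A⊛Δ t (s≤s z≤n)) N ⟩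
        ((A t ⊛ Δ t) ⊛ R₁) N  ≡⟨ ⊛-assoc (A t) (Δ t) R₁ N ⟩
        (A t ⊛ (Δ t ⊛ R₁)) N  ≡⟨ ⊛-congʳ (A t) (⊛-comm (Δ t) R₁) N ⟩
        (A t ⊛ (R₁ ⊛ Δ t)) N  ≡⟨ sym (⊛-assoc (A t) R₁ (Δ t) N) ⟩
        ((A t ⊛ R₁) ⊛ Δ t) N  ∎
      marked-later : (A t ⊛ R′ t len) N ≡ ((A t ⊛ R₁) ⊛ D₁) N
      marked-later = trans (⊛-congʳ (A t) (R′≗R⊛D t len) N) (sym (⊛-assoc (A t) R₁ D₁ N))

    Δ-coeff : ∀ t y → Δ t y ≡ 𝟙 (rFree r t) * 𝟙 (y ≡ᵇ t ℕ.* s)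
    Δ-coeff t y with rFree r t
    ... | true = sym (ℤP.*-identityˡ _)
    ... | false = refl

    D-coeff : ∀ o len y → D o len y ≡ sumℤ< len (λ p → Δ (suc (o ℕ.+ p)) y)
    D-coeff o zero y = refl
    D-coeff o (suc len) y = begin
      Δ (suc o) y + D (suc o) len y
        ≡⟨ cong₂ _+_ (cong (λ u → Δ (suc u) y) (sym (ℕP.+-identityʳ o)))
                     (trans (D-coeff (suc o) len y) (Σ-ext len (λ p → cong (λ u → Δ (suc u) y) (sym (ℕP.+-suc o p))))) ⟩
      Δ (suc (o ℕ.+ 0)) y + sumℤ< len (λ p → Δ (suc (o ℕ.+ suc p)) y)
        ≡⟨ sym (Σ-head len (λ p → Δ (suc (o ℕ.+ p)) y)) ⟩
      sumℤ< (suc len) (λ p → Δ (suc (o ℕ.+ p)) y) ∎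

    W-series : ∀ n → + W r s n ≡ (Φ r ⊛ freeMultiples n s) n
    W-series n = begin
      + W r s n
        ≡⟨ +-sum (CP r n) (bigMults s) ⟩
      ΣL (CP r n) (λ v → + bigMults s v)
        ≡⟨ ΣL-filter (vecsBounded n n) _ _ ⟩
      ΣL (vecsBounded n n) (λ v → 𝟙 (admissible 0 n v) * + bigMults s v)
        ≡⟨ ΣL-ext (vecsBounded n n) (λ v → cong (𝟙 (admissible 0 n v) *_) (bigMults-mark v)) ⟩
      ΣL (vecsBounded n n) (λ v → 𝟙 (admissible 0 n v) * mark v)
        ≡⟨ count-marked 0 n n n ℕP.≤-refl ⟩
      R′ 0 n n
        ≡⟨ R′≗R⊛D 0 n n ⟩
      (R 0 n ⊛ D 0 n) n
        ≡⟨ Σ-cong (suc n) (λ a a< → cong₂ _*_ (R-Φ n a (ℕP.≤-pred a<)) (D-freeMultiples (n ∸ a))) ⟩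
      (Φ r ⊛ freeMultiples n s) n ∎
      where
      bigMults-mark : ∀ (v : Vec ℕ n) → + bigMults s v ≡ mark v
      bigMults-mark v = trans (+-sumFin (λ p → if s ≤ᵇ lookup v p then 1 else 0))
                              (sumFinℤ-ext (λ p → +-if (s ≤ᵇ lookup v p) 1 0))
      D-freeMultiples : ∀ y → D 0 n y ≡ freeMultiples n s y
      D-freeMultiples y = trans (D-coeff 0 n y) (Σ-ext n (λ p → Δ-coeff (suc p) y))

coprime-1 : ∀ a → Coprime a 1
coprime-1 a = coprime-sym (1-coprimeTo a)

coprime-* : ∀ {a b c} → Coprime a b → Coprime a c → Coprime a (b ℕ.* c)
coprime-* {a} {b} {c} cab cac {d} (d∣a , d∣bc) = cac (d∣a , coprime-divisor cdb d∣bc)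
  where
  cdb : Coprime d b
  cdb (e∣d , e∣b) = cab (∣-trans e∣d d∣a , e∣b)

coprime-^ : ∀ {a b} → Coprime a b → ∀ e → Coprime a (b ^ e)
coprime-^ {a} cab zero = coprime-1 a
coprime-^ cab (suc e) = coprime-* cab (coprime-^ cab e)

coprime-prodFin : ∀ {m} a (f : Fin m → ℕ) → (∀ l → Coprime a (f l)) → Coprime a (prodFin f)
coprime-prodFin {zero} a f h = coprime-1 a
coprime-prodFin {suc m} a f h = coprime-* (h zero) (coprime-prodFin a (λ l → f (suc l)) (λ l → h (suc l)))

PairwiseCoprime : ∀ {m} → (Fin m → ℕ) → Set
PairwiseCoprime r = ∀ l l′ → l ≢ l′ → Coprime (r l) (r l′)

PairwiseCoprime-tail : ∀ {m} (r : Fin (suc m) → ℕ) → PairwiseCoprime r → PairwiseCoprime (λ l → r (suc l))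
PairwiseCoprime-tail r pw l l′ ne = pw (suc l) (suc l′) (λ e → ne (FinP.suc-injective e))

𝟙-dv-* : ∀ a b w → Coprime a b → 𝟙 (dv (a ℕ.* b) w) ≡ 𝟙 (dv a w) * 𝟙 (dv b w)
𝟙-dv-* a b w cab with a ∣? w | b ∣? w
... | yes p | yes q = cong 𝟙 (dv-true (both p q))
  where
  both : a ∣ w → b ∣ w → a ℕ.* b ∣ w
  both (divides u wu) bw = subst (a ℕ.* b ∣_) (trans (ℕP.*-comm a u) (sym wu))
    (*-monoʳ-∣ a (coprime-divisor (coprime-sym cab) (subst (b ∣_) (trans wu (ℕP.*-comm u a)) bw)))
... | yes p | no q = cong 𝟙 (dv-false (λ d → q (∣-trans (divides a refl) d)))
... | no p | yes q = cong 𝟙 (dv-false (λ d → p (∣-trans (divides b (ℕP.*-comm a b)) d)))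
... | no p | no q = cong 𝟙 (dv-false (λ d → p (∣-trans (divides b (ℕP.*-comm a b)) d)))

incr : ∀ {m} → Fin m → Vec ℕ m → Vec ℕ m
incr zero (x ∷ k) = suc x ∷ k
incr (suc l) (x ∷ k) = x ∷ incr l k

decr : ∀ {m} → Fin m → Vec ℕ m → Vec ℕ m
decr zero (x ∷ k) = (x ∸ 1) ∷ k
decr (suc l) (x ∷ k) = x ∷ decr l k

clear : ∀ {m} → Fin m → Vec ℕ m → Vec ℕ m
clear zero (x ∷ k) = 0 ∷ k
clear (suc l) (x ∷ k) = x ∷ clear l k

incr-decr : ∀ {m} (l : Fin m) k → 1 ≤ lookup k l → incr l (decr l k) ≡ k
incr-decr zero (suc x ∷ k) _ = refl
incr-decr (suc l) (x ∷ k) h = cong (x ∷_) (incr-decr l k h)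

lookup-clear : ∀ {m} (l : Fin m) k → lookup (clear l k) l ≡ 0
lookup-clear zero (x ∷ k) = refl
lookup-clear (suc l) (x ∷ k) = lookup-clear l k

lookup-incr≤ : ∀ {m} (l l′ : Fin m) k → lookup (incr l k) l′ ≤ suc (lookup k l′)
lookup-incr≤ zero zero (x ∷ k) = ℕP.≤-refl
lookup-incr≤ zero (suc l′) (x ∷ k) = ℕP.n≤1+n _
lookup-incr≤ (suc l) zero (x ∷ k) = ℕP.n≤1+n _
lookup-incr≤ (suc l) (suc l′) (x ∷ k) = lookup-incr≤ l l′ k

replicate-0 : ∀ {m} (k : Vec ℕ m) → (∀ l → lookup k l ≡ 0) → k ≡ replicate m 0
replicate-0 [] h = refl
replicate-0 (x ∷ k) h = cong₂ _∷_ (h zero) (replicate-0 k (λ l → h (suc l)))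

powProd-0 : ∀ {m} (r : Fin m → ℕ) → powProd r (replicate m 0) ≡ 1
powProd-0 {zero} r = refl
powProd-0 {suc m} r = trans (ℕP.+-identityʳ _) (powProd-0 (λ l → r (suc l)))

powProd-incr : ∀ {m} (r : Fin m → ℕ) l k → powProd r (incr l k) ≡ r l ℕ.* powProd r k
powProd-incr r zero (x ∷ k) = ℕP.*-assoc (r zero) (r zero ^ x) _
powProd-incr r (suc l) (x ∷ k) rewrite powProd-incr (λ l → r (suc l)) l k =
  trans (sym (ℕP.*-assoc (r zero ^ x) (r (suc l)) _))
    (trans (cong (ℕ._* powProd (λ l → r (suc l)) k) (ℕP.*-comm (r zero ^ x) (r (suc l))))
      (ℕP.*-assoc (r (suc l)) (r zero ^ x) _))

powProd-clear : ∀ {m} (r : Fin m → ℕ) l k → powProd r k ≡ r l ^ lookup k l ℕ.* powProd r (clear l k)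
powProd-clear r zero (x ∷ k) = cong (r zero ^ x ℕ.*_) (sym (ℕP.+-identityʳ _))
powProd-clear r (suc l) (x ∷ k) rewrite powProd-clear (λ l → r (suc l)) l k =
  trans (sym (ℕP.*-assoc (r zero ^ x) (r (suc l) ^ lookup k l) _))
    (trans (cong (ℕ._* powProd (λ l → r (suc l)) (clear l k)) (ℕP.*-comm (r zero ^ x) (r (suc l) ^ lookup k l)))
      (ℕP.*-assoc (r (suc l) ^ lookup k l) (r zero ^ x) _))

^-∣-powProd : ∀ {m} (r : Fin m → ℕ) l k → r l ^ lookup k l ∣ powProd r k
^-∣-powProd r l k = divides (powProd r (clear l k)) (trans (powProd-clear r l k) (ℕP.*-comm _ (powProd r (clear l k))))

powProd≥1 : ∀ {m} (r : Fin m → ℕ) → (∀ l → 1 ≤ r l) → ∀ k → 1 ≤ powProd r k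
powProd≥1 {zero} r h [] = ℕP.≤-refl
powProd≥1 {suc m} r h (x ∷ k) =
  ℕP.*-mono-≤ {1} {r zero ^ x} {1} (ℕP.m^n>0 (r zero) {{ℕ.>-nonZero (h zero)}} x) (powProd≥1 (λ l → r (suc l)) (λ l → h (suc l)) k)

-- r_l is coprime to every r^k with k_l = 0, so it cannot divide r^k j
-- unless it divides j.
∤-powProd-* : ∀ {m} (r : Fin m → ℕ) → PairwiseCoprime r → ∀ l k j → lookup k l ≡ 0 → ¬ r l ∣ j →
  ¬ r l ∣ powProd r k ℕ.* j
∤-powProd-* {suc m} r pw zero (.0 ∷ k) j refl r∤j r∣ =
  r∤j (coprime-divisor (coprime-prodFin (r zero) _ (λ l → coprime-^ (pw zero (suc l) (λ ())) (lookup k l)))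
    (subst (r zero ∣_) (cong (ℕ._* j) (ℕP.+-identityʳ (powProd (λ l → r (suc l)) k))) r∣))
∤-powProd-* {suc m} r pw (suc l) (x ∷ k) j e r∤j r∣ =
  ∤-powProd-* (λ l → r (suc l)) (PairwiseCoprime-tail r pw) l k j e r∤j
    (coprime-divisor (coprime-^ (pw (suc l) zero (λ ())) x) (subst (r (suc l) ∣_) (ℕP.*-assoc (r zero ^ x) _ j) r∣))

^-∣-^ : ∀ a e f → e ≤ f → a ^ e ∣ a ^ f
^-∣-^ a e f le = divides (a ^ (f ∸ e)) (trans (cong (a ^_) (sym (ℕP.m∸n+n≡m le))) (ℕP.^-distribˡ-+-* a (f ∸ e) e))

-- Unique factorisation  z = r^k · j  with j r-free, for pairwise coprime
-- r_l ≥ 2.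

module Factorisation {m} (r : Fin m → ℕ) (r≥2 : ∀ l → 2 ≤ r l) (pw : PairwiseCoprime r) where

  r≥1 : ∀ l → 1 ≤ r l
  r≥1 l = ℕP.≤-trans (s≤s z≤n) (r≥2 l)

  cofactor< : ∀ z q l → z ≡ q ℕ.* r l → 1 ≤ q → q < z
  cofactor< z q l zq q≥1 = subst (q <_) (sym zq) (ℕP.m<m*n q (r l) ⦃ ℕ.>-nonZero q≥1 ⦄ (r≥2 l))

  record Factorised (z : ℕ) : Set where
    field
      exps      : Vec ℕ m
      core      : ℕ
      exps<     : ∀ l → lookup exps l < z
      core≥1    : 1 ≤ core
      core≤     : core ≤ z
      core-free : rFree r core ≡ true
      recompose : powProd r exps ℕ.* core ≡ z
      unique    : ∀ k j → rFree r j ≡ true → powProd r k ℕ.* j ≡ z → k ≡ exps × j ≡ core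

  factorise-free : ∀ z → 1 ≤ z → rFree r z ≡ true → Factorised z
  factorise-free z z≥1 free = record
    { exps = replicate m 0 ; core = z
    ; exps< = λ l → subst (_< z) (sym (VecP.lookup-replicate l 0)) z≥1
    ; core≥1 = z≥1 ; core≤ = ℕP.≤-refl ; core-free = free
    ; recompose = trans (cong (ℕ._* z) (powProd-0 r)) (ℕP.*-identityˡ z)
    ; unique = unique }
    where
    unique : ∀ k j → rFree r j ≡ true → powProd r k ℕ.* j ≡ z → k ≡ replicate m 0 × j ≡ z
    unique k j _ e = k≡0 , trans (sym (ℕP.*-identityˡ j)) (trans (cong (ℕ._* j) (sym r^k≡1)) e)
      where
      no-exponent : ∀ l → lookup k l ≡ 0
      no-exponent l with lookup k l in el
      ... | zero = refl
      ... | suc x = ⊥-elim (rFree⇒∤ r z free l (∣-trans (divides (r l ^ x) (ℕP.*-comm (r l) _))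
                (∣-trans (subst (λ u → r l ^ u ∣ powProd r k) el (^-∣-powProd r l k))
                  (subst (powProd r k ∣_) e (∣m⇒∣m*n j ∣-refl)))))
      k≡0 : k ≡ replicate m 0
      k≡0 = replicate-0 k no-exponent
      r^k≡1 : powProd r k ≡ 1
      r^k≡1 = trans (cong (powProd r) k≡0) (powProd-0 r)

  factorise-step : ∀ z q l → z ≡ q ℕ.* r l → Factorised q → Factorised z
  factorise-step z q l zq Fq = record
    { exps = incr l (exps Fq) ; core = core Fq
    ; exps< = λ l′ → ℕP.<-≤-trans (s≤s (ℕP.≤-trans (lookup-incr≤ l l′ (exps Fq)) (exps< Fq l′))) q<z
    ; core≥1 = core≥1 Fq ; core≤ = ℕP.≤-trans (core≤ Fq) (ℕP.<⇒≤ q<z) ; core-free = core-free Fq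
    ; recompose = recompose′ ; unique = unique′ }
    where
    open Factorised
    instance
      r≢0 : NonZero (r l)
      r≢0 = ℕ.>-nonZero (r≥1 l)
    q≥1 : 1 ≤ q
    q≥1 = ℕP.≤-trans (core≥1 Fq) (core≤ Fq)
    q<z : q < z
    q<z = cofactor< z q l zq q≥1
    recompose′ : powProd r (incr l (exps Fq)) ℕ.* core Fq ≡ z
    recompose′ = begin
      powProd r (incr l (exps Fq)) ℕ.* core Fq    ≡⟨ cong (ℕ._* core Fq) (powProd-incr r l (exps Fq)) ⟩
      r l ℕ.* powProd r (exps Fq) ℕ.* core Fq     ≡⟨ ℕP.*-assoc (r l) _ (core Fq) ⟩
      r l ℕ.* (powProd r (exps Fq) ℕ.* core Fq)   ≡⟨ cong (r l ℕ.*_) (recompose Fq) ⟩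
      r l ℕ.* q                                   ≡⟨ ℕP.*-comm (r l) q ⟩
      q ℕ.* r l                                   ≡⟨ sym zq ⟩
      z                                           ∎
    unique′ : ∀ k j → rFree r j ≡ true → powProd r k ℕ.* j ≡ z → k ≡ incr l (exps Fq) × j ≡ core Fq
    unique′ k j free e = trans (sym k-restored) (cong (incr l) (proj₁ unique-q)) , proj₂ unique-q
      where
      -- r_l ∣ z, but r_l ∤ j, so the exponent of r_l in k is positive
      k-has-l : 1 ≤ lookup k l
      k-has-l with lookup k l in el
      ... | suc _ = s≤s z≤n
      ... | zero = ⊥-elim (∤-powProd-* r pw l k j el (rFree⇒∤ r j free l) (subst (r l ∣_) (sym e) (divides q zq)))
      k-restored : incr l (decr l k) ≡ k
      k-restored = incr-decr l k k-has-l
      e′ : powProd r (decr l k) ℕ.* j ≡ q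
      e′ = ℕP.*-cancelˡ-≡ _ _ (r l) (begin
        r l ℕ.* (powProd r (decr l k) ℕ.* j) ≡⟨ sym (ℕP.*-assoc (r l) _ j) ⟩
        r l ℕ.* powProd r (decr l k) ℕ.* j   ≡⟨ cong (ℕ._* j) (sym (powProd-incr r l (decr l k))) ⟩
        powProd r (incr l (decr l k)) ℕ.* j  ≡⟨ cong (λ u → powProd r u ℕ.* j) k-restored ⟩
        powProd r k ℕ.* j                    ≡⟨ e ⟩
        z                                    ≡⟨ zq ⟩
        q ℕ.* r l                            ≡⟨ ℕP.*-comm q (r l) ⟩
        r l ℕ.* q                            ∎)
      unique-q : decr l k ≡ exps Fq × j ≡ core Fq
      unique-q = unique Fq (decr l k) j free e′

  -- Every z ≥ 1 factorises, by strong induction: divide out some r_l ∣ z.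
  factorise : ∀ z → 1 ≤ z → Factorised z
  factorise = <-rec (λ z → 1 ≤ z → Factorised z) step
    where
    step : ∀ z → (∀ {q} → q < z → 1 ≤ q → Factorised q) → 1 ≤ z → Factorised z
    step z rec z≥1 with rFree r z in free
    ... | true = factorise-free z z≥1 free
    ... | false with ¬rFree⇒∣ r z free
    ...   | l , divides q zq = factorise-step z q l zq (rec q<z q≥1)
      where
      q≥1 : 1 ≤ q
      q≥1 = ℕP.n≢0⇒n>0 (λ q≡0 → ℕP.<-irrefl refl (subst (1 ≤_) (trans zq (cong (ℕ._* r l) q≡0)) z≥1))
      q<z : q < z
      q<z = cofactor< z q l zq q≥1

  module _ {z} (F : Factorised z) where
    open Factorised F

    exps-≥⇒∣ : ∀ l e → e ≤ lookup exps l → r l ^ e ∣ z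
    exps-≥⇒∣ l e le = ∣-trans (^-∣-^ (r l) e _ le)
      (∣-trans (^-∣-powProd r l exps) (subst (powProd r exps ∣_) recompose (∣m⇒∣m*n core ∣-refl)))

    ∣⇒exps-≥ : ∀ l e → r l ^ e ∣ z → e ≤ lookup exps l
    ∣⇒exps-≥ l e d with e ℕ.≤? lookup exps l
    ... | yes le = le
    ... | no nle = ⊥-elim (∤-powProd-* r pw l (clear l exps) core (lookup-clear l exps) (rFree⇒∤ r core core-free l) r∣rest)
      where
      κ : ℕ
      κ = lookup exps l
      instance
        r^κ≢0 : NonZero (r l ^ κ)
        r^κ≢0 = ℕP.m^n≢0 (r l) κ {{ℕ.>-nonZero (r≥1 l)}}
      r^κ⁺¹∣ : r l ^ κ ℕ.* r l ∣ r l ^ κ ℕ.* (powProd r (clear l exps) ℕ.* core)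
      r^κ⁺¹∣ = subst₂ _∣_ (ℕP.*-comm (r l) (r l ^ κ))
               (trans (sym recompose) (trans (cong (ℕ._* core) (powProd-clear r l exps)) (ℕP.*-assoc (r l ^ κ) _ core)))
               (∣-trans (^-∣-^ (r l) (suc κ) e (ℕP.≰⇒> nle)) d)
      r∣rest : r l ∣ powProd r (clear l exps) ℕ.* core
      r∣rest = *-cancelˡ-∣ (r l ^ κ) r^κ⁺¹∣

Σ-multiple : ∀ N c w q (h : ℕ → ℤ) → 1 ≤ c → w ≡ q ℕ.* c → q < N →
  sumℤ< N (λ j → 𝟙 (w ≡ᵇ c ℕ.* j) * h j) ≡ h q
Σ-multiple N (suc c) w q h _ wq q<N = begin
  sumℤ< N (λ j → 𝟙 (w ≡ᵇ suc c ℕ.* j) * h j)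
    ≡⟨ Σ-ext N (λ j → cong (_* h j) (𝟙-≡ᵇ-iff
        (λ e → ℕP.*-cancelˡ-≡ j q (suc c) (trans (sym e) (trans wq (ℕP.*-comm q (suc c)))))
        (λ e → trans wq (trans (ℕP.*-comm q (suc c)) (cong (suc c ℕ.*_) (sym e)))))) ⟩
  sumℤ< N (λ j → 𝟙 (j ≡ᵇ q) * h j) ≡⟨ Σ-pick N q h ⟩
  𝟙 (q ℕ.<ᵇ N) * h q                ≡⟨ cong (λ b → 𝟙 b * h q) (≤⇒≤ᵇ-true {suc q} {N} q<N) ⟩
  + 1 * h q                         ≡⟨ ℤP.*-identityˡ (h q) ⟩
  h q                               ∎

Σ-multiple-none : ∀ N c w (h : ℕ → ℤ) → ¬ c ∣ w → sumℤ< N (λ j → 𝟙 (w ≡ᵇ c ℕ.* j) * h j) ≡ + 0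
Σ-multiple-none N c w h c∤w = Σ-zero N (λ j _ → cong (_* h j)
  (cong 𝟙 (≢⇒≡ᵇ-false w (c ℕ.* j) (λ e → c∤w (divides j (trans e (ℕP.*-comm c j)))))))

quotient-bounds : ∀ {w q P} → 1 ≤ P → 1 ≤ w → w ≡ q ℕ.* P → 1 ≤ q × q ≤ w
quotient-bounds {w} {q} P≥1 w≥1 wq =
  ℕP.n≢0⇒n>0 (λ q≡0 → ℕP.<-irrefl refl (subst (1 ≤_) (trans wq (cong (ℕ._* _) q≡0)) w≥1)) ,
  subst (q ≤_) (sym wq) (ℕP.m≤m*n q _ ⦃ ℕ.>-nonZero P≥1 ⦄)

𝟙-dv-as-Σ : ∀ P w y → 1 ≤ P → 1 ≤ w → w ≤ y → 𝟙 (dv P w) ≡ sumℤ< y (λ u → 𝟙 (w ≡ᵇ P ℕ.* suc u))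
𝟙-dv-as-Σ P w y P≥1 w≥1 w≤y with P ∣? w
... | no P∤w = sym (Σ-zero y (λ u _ → cong 𝟙 (≢⇒≡ᵇ-false w _ (λ e → P∤w (divides (suc u) (trans e (ℕP.*-comm P (suc u))))))))
... | yes (divides q wq) = sym (begin
  sumℤ< y (λ u → 𝟙 (w ≡ᵇ P ℕ.* suc u))
    ≡⟨ Σ-ext y (λ u → trans (𝟙-≡ᵇ-iff {w} {P ℕ.* suc u} {q} {suc u}
         (λ e → ℕP.*-cancelʳ-≡ q (suc u) P ⦃ ℕ.>-nonZero P≥1 ⦄ (trans (sym wq) (trans e (ℕP.*-comm P (suc u)))))
         (λ e → trans wq (trans (cong (ℕ._* P) e) (ℕP.*-comm (suc u) P)))) (sym (ℤP.*-identityʳ _))) ⟩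
  sumℤ< y (λ u → 𝟙 (q ≡ᵇ suc u) * + 1)
    ≡⟨ Σ-pick-suc y q (λ _ → + 1) q≥1 (λ lt → ⊥-elim (ℕP.<-irrefl refl (ℕP.<-≤-trans lt q≤y))) ⟩
  + 1 ∎)
  where
  q≥1 : 1 ≤ q
  q≥1 = proj₁ (quotient-bounds P≥1 w≥1 wq)
  q≤y : q ≤ y
  q≤y = ℕP.≤-trans (proj₂ (quotient-bounds P≥1 w≥1 wq)) w≤y

Σ-cofactor-dv : ∀ n y t d → 1 ≤ y → y ≤ n → 1 ≤ t →
  sumℤ< n (λ z → 𝟙 (y ≡ᵇ t ℕ.* suc z) * 𝟙 (dv d (suc z))) ≡ 𝟙 (dv (t ℕ.* d) y)
Σ-cofactor-dv n y t d y≥1 y≤n t≥1 with t ∣? y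
... | no t∤y = trans (Σ-zero n (λ z _ → cong (_* 𝟙 (dv d (suc z)))
        (cong 𝟙 (≢⇒≡ᵇ-false y (t ℕ.* suc z) (λ e → t∤y (divides (suc z) (trans e (ℕP.*-comm t (suc z)))))))))
      (sym (cong 𝟙 (dv-false (λ p → t∤y (∣-trans (∣m⇒∣m*n d ∣-refl) p)))))
... | yes (divides w yw) = begin
  sumℤ< n (λ z → 𝟙 (y ≡ᵇ t ℕ.* suc z) * 𝟙 (dv d (suc z)))
    ≡⟨ Σ-ext n (λ z → cong (_* 𝟙 (dv d (suc z))) (𝟙-≡ᵇ-iff {y} {t ℕ.* suc z} {w} {suc z}
         (λ e → ℕP.*-cancelʳ-≡ w (suc z) t ⦃ t≢0 ⦄ (trans (sym yw) (trans e (ℕP.*-comm t (suc z)))))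
         (λ e → trans yw (trans (cong (ℕ._* t) e) (ℕP.*-comm (suc z) t))))) ⟩
  sumℤ< n (λ z → 𝟙 (w ≡ᵇ suc z) * 𝟙 (dv d (suc z)))
    ≡⟨ Σ-pick-suc n w (λ u → 𝟙 (dv d u)) w≥1 (λ lt → ⊥-elim (ℕP.<-irrefl refl (ℕP.<-≤-trans lt w≤n))) ⟩
  𝟙 (dv d w)
    ≡⟨ 𝟙-dv-iff (λ p → subst (t ℕ.* d ∣_) (trans (ℕP.*-comm t w) (sym yw)) (*-monoʳ-∣ t p))
                (λ p → *-cancelˡ-∣ t ⦃ t≢0 ⦄ (subst (t ℕ.* d ∣_) (trans yw (ℕP.*-comm w t)) p)) ⟩
  𝟙 (dv (t ℕ.* d) y) ∎
  where
  t≢0 : NonZero t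
  t≢0 = ℕ.>-nonZero t≥1
  w≥1 : 1 ≤ w
  w≥1 = proj₁ (quotient-bounds t≥1 y≥1 yw)
  w≤n : w ≤ n
  w≤n = ℕP.≤-trans (proj₂ (quotient-bounds t≥1 y≥1 yw)) y≤n

frac-coeff : ∀ b y → 1 ≤ b → 1 ≤ y → frac b y ≡ 𝟙 (dv b y)
frac-coeff b y b≥1 y≥1 = begin
  sumℤ< (suc y) (λ a → 𝟙 (a ≡ᵇ b) * geom b (y ∸ a)) ≡⟨ Σ-pick (suc y) b (λ a → geom b (y ∸ a)) ⟩
  𝟙 (b ℕ.<ᵇ suc y) * geom b (y ∸ b)               ≡⟨ cong (λ u → 𝟙 u * geom b (y ∸ b)) (<ᵇ-suc b y) ⟩
  𝟙 (b ≤ᵇ y) * geom b (y ∸ b)                     ≡⟨ by-cases ⟩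
  𝟙 (dv b y)                                      ∎
  where
  geom-as-Σ : geom b (y ∸ b) ≡ sumℤ< (suc (y ∸ b)) (λ j → 𝟙 (y ∸ b ≡ᵇ b ℕ.* j) * + 1)
  geom-as-Σ = Σ-ext (suc (y ∸ b)) (λ j → sym (ℤP.*-identityʳ _))
  by-cases : 𝟙 (b ≤ᵇ y) * geom b (y ∸ b) ≡ 𝟙 (dv b y)
  by-cases with b ℕ.≤? y
  ... | no b≰y rewrite ≰⇒≤ᵇ-false b≰y = sym (cong 𝟙 (dv-false (λ p → b≰y (∣⇒≤ ⦃ ℕ.>-nonZero y≥1 ⦄ p))))
  ... | yes b≤y rewrite ≤⇒≤ᵇ-true b≤y with b ∣? y
  ...   | yes (divides q yq) =
          trans (ℤP.*-identityˡ _) (trans geom-as-Σ (Σ-multiple (suc (y ∸ b)) b (y ∸ b) (q ∸ 1) (λ _ → + 1) b≥1 y-b lt))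
    where
    y-b : y ∸ b ≡ (q ∸ 1) ℕ.* b
    y-b = trans (cong (_∸ b) yq) (trans (cong (q ℕ.* b ∸_) (sym (ℕP.*-identityˡ b))) (sym (ℕP.*-distribʳ-∸ b q 1)))
    lt : q ∸ 1 < suc (y ∸ b)
    lt = s≤s (subst (q ∸ 1 ≤_) (sym y-b) (ℕP.m≤m*n (q ∸ 1) b ⦃ ℕ.>-nonZero b≥1 ⦄))
  ...   | no b∤y = trans (ℤP.*-identityˡ _) (trans geom-as-Σ (Σ-multiple-none (suc (y ∸ b)) b (y ∸ b) (λ _ → + 1)
              (λ p → b∤y (subst (b ∣_) (ℕP.m∸n+n≡m b≤y) (∣m∣n⇒∣m+n p ∣-refl)))))

-- [q^y] Σ_{u≥1} q^{a P u}/(1 - q^{a P u}) = Σ_{w ≤ y} [P ∣ w] [a w ∣ y]: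
-- the Lambert series of a P, grouped by the multiple w = P u.
lambert-coeff : ∀ a P y → 1 ≤ a → 1 ≤ P →
  lambert (a ℕ.* P) y ≡ sumℤ< y (λ w → 𝟙 (dv P (suc w)) * 𝟙 (dv (a ℕ.* suc w) y))
lambert-coeff a P zero a≥1 P≥1 = refl
lambert-coeff a P (suc y′) a≥1 P≥1 = begin
  sumℤ< y (λ u → frac (a ℕ.* P ℕ.* suc u) y)
    ≡⟨ Σ-ext y (λ u → trans (frac-coeff _ y (ℕP.*-mono-≤ (ℕP.*-mono-≤ a≥1 P≥1) (s≤s z≤n)) (s≤s z≤n))
                        (cong (λ v → 𝟙 (dv v y)) (ℕP.*-assoc a P (suc u)))) ⟩
  sumℤ< y (λ u → h (P ℕ.* suc u))
    ≡⟨ sym (Σ-ext y (λ u → Σ-pick-suc y (P ℕ.* suc u) h (ℕP.*-mono-≤ P≥1 (s≤s z≤n)) (too-big u))) ⟩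
  sumℤ< y (λ u → sumℤ< y (λ w → 𝟙 (P ℕ.* suc u ≡ᵇ suc w) * h (suc w)))
    ≡⟨ Σ-swap y y _ ⟩
  sumℤ< y (λ w → sumℤ< y (λ u → 𝟙 (P ℕ.* suc u ≡ᵇ suc w) * h (suc w)))
    ≡⟨ Σ-cong y (λ w w<y → trans (sym (Σ-*ʳ y (h (suc w)) _))
          (cong (_* h (suc w)) (trans (Σ-ext y (λ u → cong 𝟙 (≡ᵇ-sym (P ℕ.* suc u) (suc w))))
             (sym (𝟙-dv-as-Σ P (suc w) y P≥1 (s≤s z≤n) w<y))))) ⟩
  sumℤ< y (λ w → 𝟙 (dv P (suc w)) * 𝟙 (dv (a ℕ.* suc w) y)) ∎
  where
  y : ℕ
  y = suc y′
  h : ℕ → ℤ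
  h u = 𝟙 (dv (a ℕ.* u) y)
  too-big : ∀ u → y < P ℕ.* suc u → h (P ℕ.* suc u) ≡ + 0
  too-big u lt = 𝟙-dv-big _ y (s≤s z≤n) (ℕP.<-≤-trans lt
    (subst (_≤ a ℕ.* (P ℕ.* suc u)) (ℕP.*-identityˡ _) (ℕP.*-monoˡ-≤ (P ℕ.* suc u) a≥1)))

bracketB-coeff : ∀ {m} (r : Fin m → ℕ) i → 1 ≤ r i → ∀ y →
  bracketB r i y ≡ sumℤ< y (λ u → 𝟙 (rFreeExcept r i (suc u)) * 𝟙 (dv (r i ℕ.* suc u) y))
bracketB-coeff r i rᵢ≥1 zero = refl
bracketB-coeff r i rᵢ≥1 (suc y′) = Σ-ext (suc y′) term-coeff
  where
  term-coeff : ∀ u → (if rFreeExcept r i (suc u) then frac (r i ℕ.* suc u) else zeroS) (suc y′)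
                     ≡ 𝟙 (rFreeExcept r i (suc u)) * 𝟙 (dv (r i ℕ.* suc u) (suc y′))
  term-coeff u with rFreeExcept r i (suc u)
  ... | true = trans (frac-coeff (r i ℕ.* suc u) (suc y′) (ℕP.*-mono-≤ rᵢ≥1 (s≤s z≤n)) (s≤s z≤n)) (sym (ℤP.*-identityˡ _))
  ... | false = refl

vecEq : ∀ {m} → Vec ℕ m → Vec ℕ m → Bool
vecEq [] [] = true
vecEq (x ∷ k) (y ∷ k′) = (x ≡ᵇ y) ∧ vecEq k k′

vecEq-true⇒≡ : ∀ {m} (k k′ : Vec ℕ m) → vecEq k k′ ≡ true → k ≡ k′
vecEq-true⇒≡ [] [] _ = refl
vecEq-true⇒≡ (x ∷ k) (y ∷ k′) e with x ≡ᵇ y in ex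
... | true = cong₂ _∷_ (≡ᵇ-true⇒≡ x y ex) (vecEq-true⇒≡ k k′ e)

vecEq-refl : ∀ {m} (k : Vec ℕ m) → vecEq k k ≡ true
vecEq-refl [] = refl
vecEq-refl (x ∷ k) rewrite ≡ᵇ-refl x = vecEq-refl k

Σ-vecs-pick : ∀ m b (k₀ : Vec ℕ m) (Ψ : Vec ℕ m → ℤ) → (∀ l → lookup k₀ l ≤ b) →
  ΣL (vecsBounded m b) (λ k → 𝟙 (vecEq k k₀) * Ψ k) ≡ Ψ k₀
Σ-vecs-pick zero b [] Ψ _ = trans (ℤP.+-identityʳ _) (ℤP.*-identityˡ _)
Σ-vecs-pick (suc m) b (y ∷ k₀) Ψ bounded = begin
  ΣL (vecsBounded (suc m) b) (λ k → 𝟙 (vecEq k (y ∷ k₀)) * Ψ k)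
    ≡⟨ vecsBounded-split m b _ ⟩
  sumℤ< (suc b) (λ x → ΣL (vecsBounded m b) (λ k → 𝟙 ((x ≡ᵇ y) ∧ vecEq k k₀) * Ψ (x ∷ k)))
    ≡⟨ Σ-ext (suc b) (λ x → trans (ΣL-ext (vecsBounded m b) (λ k → trans (cong (_* Ψ (x ∷ k)) (𝟙-∧ (x ≡ᵇ y) (vecEq k k₀)))
          (ℤP.*-assoc (𝟙 (x ≡ᵇ y)) (𝟙 (vecEq k k₀)) (Ψ (x ∷ k)))))
          (sym (ΣL-*ˡ (vecsBounded m b) (𝟙 (x ≡ᵇ y)) (λ k → 𝟙 (vecEq k k₀) * Ψ (x ∷ k))))) ⟩
  sumℤ< (suc b) (λ x → 𝟙 (x ≡ᵇ y) * ΣL (vecsBounded m b) (λ k → 𝟙 (vecEq k k₀) * Ψ (x ∷ k)))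
    ≡⟨ Σ-pick (suc b) y _ ⟩
  𝟙 (y ℕ.<ᵇ suc b) * ΣL (vecsBounded m b) (λ k → 𝟙 (vecEq k k₀) * Ψ (y ∷ k))
    ≡⟨ cong₂ _*_ (cong 𝟙 (trans (<ᵇ-suc y b) (≤⇒≤ᵇ-true (bounded zero))))
                 (Σ-vecs-pick m b k₀ (λ k → Ψ (y ∷ k)) (λ l → bounded (suc l))) ⟩
  + 1 * Ψ (y ∷ k₀) ≡⟨ ℤP.*-identityˡ _ ⟩
  Ψ (y ∷ k₀) ∎

single : ∀ {m} → Fin m → ℕ → Vec ℕ m
single {suc m} zero x = x ∷ replicate m 0
single (suc i) x = 0 ∷ single i x

onlyAt : ∀ {m} → Fin m → Vec ℕ m → Bool
onlyAt i k = allFin (λ l → does (l ≟ i) ∨ (lookup k l ≡ᵇ 0))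

Σ-vecs-onlyAt : ∀ m b (i : Fin m) (F : Vec ℕ m → ℤ) →
  ΣL (vecsBounded m b) (λ k → 𝟙 (onlyAt i k) * F k) ≡ sumℤ< (suc b) (λ x → F (single i x))
Σ-vecs-onlyAt (suc m) b zero F = trans (vecsBounded-split m b _) (Σ-ext (suc b) (λ x →
  trans (ΣL-ext (vecsBounded m b) (λ k → cong (λ u → 𝟙 u * F (x ∷ k)) (all-zero k)))
        (Σ-vecs-pick m b (replicate m 0) (λ k → F (x ∷ k)) (zero-bounded m))))
  where
  all-zero : ∀ {m} (k : Vec ℕ m) → allFin (λ l → lookup k l ≡ᵇ 0) ≡ vecEq k (replicate m 0)
  all-zero [] = refl
  all-zero (x ∷ k) = cong ((x ≡ᵇ 0) ∧_) (all-zero k)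
  zero-bounded : ∀ m (l : Fin m) → lookup (replicate m 0) l ≤ b
  zero-bounded (suc m) zero = z≤n
  zero-bounded (suc m) (suc l) = zero-bounded m l
Σ-vecs-onlyAt (suc m) b (suc i) F = begin
  ΣL (vecsBounded (suc m) b) (λ k → 𝟙 (onlyAt (suc i) k) * F k)
    ≡⟨ vecsBounded-split m b _ ⟩
  sumℤ< (suc b) (λ x → ΣL (vecsBounded m b) (λ k → 𝟙 ((x ≡ᵇ 0) ∧ onlyAt i k) * F (x ∷ k)))
    ≡⟨ Σ-ext (suc b) (λ x → trans (ΣL-ext (vecsBounded m b) (λ k → trans (cong (_* F (x ∷ k)) (𝟙-∧ (x ≡ᵇ 0) (onlyAt i k)))
          (ℤP.*-assoc (𝟙 (x ≡ᵇ 0)) (𝟙 (onlyAt i k)) (F (x ∷ k)))))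
          (sym (ΣL-*ˡ (vecsBounded m b) (𝟙 (x ≡ᵇ 0)) (λ k → 𝟙 (onlyAt i k) * F (x ∷ k))))) ⟩
  sumℤ< (suc b) (λ x → 𝟙 (x ≡ᵇ 0) * ΣL (vecsBounded m b) (λ k → 𝟙 (onlyAt i k) * F (x ∷ k)))
    ≡⟨ Σ-pick (suc b) 0 _ ⟩
  + 1 * ΣL (vecsBounded m b) (λ k → 𝟙 (onlyAt i k) * F (0 ∷ k))
    ≡⟨ ℤP.*-identityˡ _ ⟩
  ΣL (vecsBounded m b) (λ k → 𝟙 (onlyAt i k) * F (0 ∷ k))
    ≡⟨ Σ-vecs-onlyAt m b i (λ k → F (0 ∷ k)) ⟩
  sumℤ< (suc b) (λ x → F (single (suc i) x)) ∎

powProd-single : ∀ {m} (r : Fin m → ℕ) i x → powProd r (single i x) ≡ r i ^ x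
powProd-single {suc m} r zero x = trans (cong (r zero ^ x ℕ.*_) (powProd-0 (λ l → r (suc l)))) (ℕP.*-identityʳ _)
powProd-single {suc m} r (suc i) x = trans (ℕP.+-identityʳ _) (powProd-single (λ l → r (suc l)) i x)

𝟙-*-iff : ∀ a b c d → (a ≡ true → b ≡ true → c ≡ true × d ≡ true) → (c ≡ true → d ≡ true → a ≡ true × b ≡ true) →
  𝟙 a * 𝟙 b ≡ 𝟙 c * 𝟙 d
𝟙-*-iff a b c d f g = begin
  𝟙 a * 𝟙 b   ≡⟨ sym (𝟙-∧ a b) ⟩
  𝟙 (a ∧ b)   ≡⟨ cong 𝟙 (BoolP.⇔→≡ {z = true} (mk⇔ (λ e → both (f (left e) (right e))) (λ e → both (g (left e) (right e))))) ⟩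
  𝟙 (c ∧ d)   ≡⟨ 𝟙-∧ c d ⟩
  𝟙 c * 𝟙 d   ∎
  where
  left : ∀ {x y} → x ∧ y ≡ true → x ≡ true
  left {true} _ = refl
  right : ∀ {x y} → x ∧ y ≡ true → y ≡ true
  right {true} e = e
  both : ∀ {x y} → x ≡ true × y ≡ true → x ∧ y ≡ true
  both (refl , refl) = refl

<-^ : ∀ a k → 2 ≤ a → k < a ^ k
<-^ a zero _ = s≤s z≤n
<-^ a (suc k) a≥2 = ℕP.<-≤-trans (s≤s ih) (ℕP.≤-trans double (ℕP.*-monoˡ-≤ (a ^ k) a≥2))
  where
  ih : suc k ≤ a ^ k
  ih = <-^ a k a≥2
  double : suc (a ^ k) ≤ 2 ℕ.* a ^ k
  double = subst (suc (a ^ k) ≤_) (sym (cong (a ^ k ℕ.+_) (ℕP.+-identityʳ (a ^ k))))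
             (subst (_≤ a ^ k ℕ.+ a ^ k) (ℕP.+-comm (a ^ k) 1) (ℕP.+-monoʳ-≤ (a ^ k) (ℕP.≤-trans (s≤s z≤n) ih)))

-- Step (2): for 1 ≤ y ≤ n, both the coefficient of q^y in
--   Σ_{j free} Σ_k k_i Σ_{t free} q^{t r^k j}
-- and that of the right bracket B equal
--   Σ_{j free} Σ_{e<n} [j r_i^{e+1} ∣ y].

module MultiplicityCount {m} (r : Fin m → ℕ) (r≥2 : ∀ l → 2 ≤ r l) (pw : PairwiseCoprime r) (i : Fin m) (n : ℕ) where

  open Factorisation r r≥2 pw
  open Factorised
  open PartitionCounting r using (freeMultiples; module Threshold)

  opaque
    ΣPairs : (Vec ℕ m → ℕ → ℤ) → ℤ
    ΣPairs f = sumℤ< n (λ j′ → 𝟙 (rFree r (suc j′)) * ΣL (vecsBounded m n) (λ k → f k (suc j′)))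

    ΣPairs-def : ∀ f → ΣPairs f ≡ sumℤ< n (λ j′ → 𝟙 (rFree r (suc j′)) * ΣL (vecsBounded m n) (λ k → f k (suc j′)))
    ΣPairs-def f = refl

    ΣPairs-ext : ∀ {f g : Vec ℕ m → ℕ → ℤ} → (∀ k j′ → f k (suc j′) ≡ g k (suc j′)) → ΣPairs f ≡ ΣPairs g
    ΣPairs-ext h = Σ-ext n (λ j′ → cong (𝟙 (rFree r (suc j′)) *_) (ΣL-ext (vecsBounded m n) (λ k → h k j′)))

    ΣPairs-*ˡ : ∀ a (f : Vec ℕ m → ℕ → ℤ) → a * ΣPairs f ≡ ΣPairs (λ k j → a * f k j)
    ΣPairs-*ˡ a f = trans (Σ-*ˡ n a _) (Σ-ext n (λ j′ →
      trans (exchange a (𝟙 (rFree r (suc j′))) _) (cong (𝟙 (rFree r (suc j′)) *_) (ΣL-*ˡ (vecsBounded m n) a _))))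
      where
      exchange : ∀ a c x → a * (c * x) ≡ c * (a * x)
      exchange = solve-∀

    ΣPairs-*ʳ : ∀ a (f : Vec ℕ m → ℕ → ℤ) → ΣPairs f * a ≡ ΣPairs (λ k j → f k j * a)
    ΣPairs-*ʳ a f = trans (ℤP.*-comm (ΣPairs f) a) (trans (ΣPairs-*ˡ a f) (ΣPairs-ext {λ k j → a * f k j} {λ k j → f k j * a} (λ k j′ → ℤP.*-comm a (f k (suc j′)))))

    ΣPairs-Σ : ∀ N (F : Vec ℕ m → ℕ → ℕ → ℤ) →
      ΣPairs (λ k j → sumℤ< N (F k j)) ≡ sumℤ< N (λ z → ΣPairs (λ k j → F k j z))
    ΣPairs-Σ N F = trans (Σ-ext n (λ j′ → trans (cong (𝟙 (rFree r (suc j′)) *_) (ΣL-Σ (vecsBounded m n) N _))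
                                                (Σ-*ˡ N (𝟙 (rFree r (suc j′))) _)))
                         (Σ-swap n N _)

    ΣPairs-zero : ΣPairs (λ _ _ → + 0) ≡ + 0
    ΣPairs-zero = Σ-zero n (λ j′ _ → trans (cong (𝟙 (rFree r (suc j′)) *_) (ΣL-zero (vecsBounded m n))) (ℤP.*-zeroʳ (𝟙 (rFree r (suc j′)))))

  r^k·j≥1 : ∀ k j′ → 1 ≤ powProd r k ℕ.* suc j′
  r^k·j≥1 k j′ = ℕP.*-mono-≤ {1} {powProd r k} {1} {suc j′} (powProd≥1 r r≥1 k) (s≤s z≤n)

  -- By unique factorisation, exactly one pair (k, j) has r^k j = z.
  ΣPairs-factorisation : ∀ z (Fz : Factorised z) (Ψ : Vec ℕ m → ℤ) → z ≤ n →
    ΣPairs (λ k j → 𝟙 (powProd r k ℕ.* j ≡ᵇ z) * Ψ k) ≡ Ψ (exps Fz)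
  ΣPairs-factorisation z Fz Ψ z≤n′ = begin
    ΣPairs (λ k j → 𝟙 (powProd r k ℕ.* j ≡ᵇ z) * Ψ k)
      ≡⟨ trans (ΣPairs-def _) (Σ-ext n (λ j′ → trans (ΣL-*ˡ (vecsBounded m n) (𝟙 (rFree r (suc j′))) (λ k → 𝟙 (powProd r k ℕ.* suc j′ ≡ᵇ z) * Ψ k))
                                                    (ΣL-ext (vecsBounded m n) (λ k → sift (suc j′) k)))) ⟩
    sumℤ< n (λ j′ → ΣL (vecsBounded m n) (λ k → 𝟙 (vecEq k (exps Fz)) * (𝟙 (suc j′ ≡ᵇ core Fz) * Ψ k)))
      ≡⟨ Σ-ext n (λ j′ → Σ-vecs-pick m n (exps Fz) _ (λ l → ℕP.<⇒≤ (ℕP.<-≤-trans (exps< Fz l) z≤n′))) ⟩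
    sumℤ< n (λ j′ → 𝟙 (suc j′ ≡ᵇ core Fz) * Ψ (exps Fz))
      ≡⟨ Σ-ext n (λ j′ → cong (λ u → 𝟙 u * Ψ (exps Fz)) (≡ᵇ-sym (suc j′) (core Fz))) ⟩
    sumℤ< n (λ j′ → 𝟙 (core Fz ≡ᵇ suc j′) * Ψ (exps Fz))
      ≡⟨ Σ-pick-suc n (core Fz) (λ _ → Ψ (exps Fz)) (core≥1 Fz)
           (λ lt → ⊥-elim (ℕP.<-irrefl refl (ℕP.<-≤-trans lt (ℕP.≤-trans (core≤ Fz) z≤n′)))) ⟩
    Ψ (exps Fz) ∎
    where
    same : ∀ j k → 𝟙 (rFree r j) * 𝟙 (powProd r k ℕ.* j ≡ᵇ z) ≡ 𝟙 (vecEq k (exps Fz)) * 𝟙 (j ≡ᵇ core Fz)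
    same j k = 𝟙-*-iff _ _ _ _
      (λ free e → let (k≡ , j≡) = unique Fz k j free (≡ᵇ-true⇒≡ _ _ e) in
        trans (cong (vecEq k) (sym k≡)) (vecEq-refl k) , trans (cong (j ≡ᵇ_) (sym j≡)) (≡ᵇ-refl j))
      (λ ek ej → let k≡ = vecEq-true⇒≡ k (exps Fz) ek ; j≡ = ≡ᵇ-true⇒≡ j (core Fz) ej in
        trans (cong (rFree r) j≡) (core-free Fz) ,
        trans (cong₂ (λ u v → powProd r u ℕ.* v ≡ᵇ z) k≡ j≡) (trans (cong (_≡ᵇ z) (recompose Fz)) (≡ᵇ-refl z)))
    sift : ∀ j k → 𝟙 (rFree r j) * (𝟙 (powProd r k ℕ.* j ≡ᵇ z) * Ψ k)
                 ≡ 𝟙 (vecEq k (exps Fz)) * (𝟙 (j ≡ᵇ core Fz) * Ψ k)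
    sift j k = trans (sym (ℤP.*-assoc (𝟙 (rFree r j)) _ (Ψ k)))
                 (trans (cong (_* Ψ k) (same j k)) (ℤP.*-assoc (𝟙 (vecEq k (exps Fz))) _ (Ψ k)))

  factorisation : ∀ z′ → Factorised (suc z′)
  factorisation z′ = factorise (suc z′) (s≤s z≤n)

  exponent-count : ∀ z′ → suc z′ ≤ n → + lookup (exps (factorisation z′)) i ≡ sumℤ< n (λ e → 𝟙 (dv (r i ^ suc e) (suc z′)))
  exponent-count z′ le = sym (trans
    (Σ-ext n (λ e → 𝟙-dv-≤ᵇ (∣⇒exps-≥ (factorisation z′) i (suc e)) (exps-≥⇒∣ (factorisation z′) i (suc e))))
    (Σ-count n _ (ℕP.<⇒≤ (ℕP.<-≤-trans (exps< (factorisation z′) i) le))))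

  rFreeExcept-onlyAt : ∀ z (Fz : Factorised z) → rFreeExcept r i z ≡ onlyAt i (exps Fz)
  rFreeExcept-onlyAt z Fz = allFin-ext (λ l → cong (does (l ≟ i) ∨_) (same l))
    where
    same : ∀ l → not (does (r l ∣? z)) ≡ (lookup (exps Fz) l ≡ᵇ 0)
    same l with r l ∣? z | lookup (exps Fz) l in e
    ... | yes p | zero = ⊥-elim (ℕP.<-irrefl refl (subst (1 ≤_) e (∣⇒exps-≥ Fz l 1 (subst (_∣ z) (sym (ℕP.*-identityʳ (r l))) p))))
    ... | yes p | suc _ = refl
    ... | no p | zero = refl
    ... | no p | suc x = ⊥-elim (p (subst (_∣ z) (ℕP.*-identityʳ (r l)) (exps-≥⇒∣ Fz l 1 (subst (1 ≤_) (sym e) (s≤s z≤n)))))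

  -- The common value of both sides in step (2).
  freeCount : ℕ → ℤ
  freeCount y = sumℤ< n (λ j′ → 𝟙 (rFree r (suc j′)) * sumℤ< n (λ e → 𝟙 (dv (suc j′ ℕ.* r i ^ suc e) y)))

  -- For t ≥ 1:  Σ_{(k,j) : y = t r^k j} k_i  =  #{e < n : t r_i^{e+1} ∣ y}.
  -- Group the pairs by z = r^k j; each z contributes its r_i-exponent.
  weighted-cofactor-count : ∀ y t → 1 ≤ y → y ≤ n → 1 ≤ t →
    ΣPairs (λ k j → 𝟙 (y ≡ᵇ t ℕ.* (powProd r k ℕ.* j)) * + lookup k i) ≡ sumℤ< n (λ e → 𝟙 (dv (t ℕ.* r i ^ suc e) y))
  weighted-cofactor-count y t y≥1 y≤n t≥1 = begin
    ΣPairs (λ k j → 𝟙 (y ≡ᵇ t ℕ.* (powProd r k ℕ.* j)) * + lookup k i)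
      ≡⟨ ΣPairs-ext {g = λ k j → sumℤ< n (λ z → 𝟙 (powProd r k ℕ.* j ≡ᵇ suc z) * (𝟙 (y ≡ᵇ t ℕ.* suc z) * + lookup k i))}
           (λ k j′ → sym (Σ-pick-suc n (powProd r k ℕ.* suc j′) (h k) (r^k·j≥1 k j′) (too-big k j′))) ⟩
    ΣPairs (λ k j → sumℤ< n (λ z → 𝟙 (powProd r k ℕ.* j ≡ᵇ suc z) * (𝟙 (y ≡ᵇ t ℕ.* suc z) * + lookup k i)))
      ≡⟨ ΣPairs-Σ n _ ⟩
    sumℤ< n (λ z → ΣPairs (λ k j → 𝟙 (powProd r k ℕ.* j ≡ᵇ suc z) * (𝟙 (y ≡ᵇ t ℕ.* suc z) * + lookup k i)))
      ≡⟨ Σ-cong n (λ z z<n → trans (ΣPairs-ext {g = λ k j → 𝟙 (y ≡ᵇ t ℕ.* suc z) * (𝟙 (powProd r k ℕ.* j ≡ᵇ suc z) * + lookup k i)}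
                                     (λ k j′ → exchange (𝟙 (powProd r k ℕ.* suc j′ ≡ᵇ suc z)) (𝟙 (y ≡ᵇ t ℕ.* suc z)) (+ lookup k i)))
           (trans (sym (ΣPairs-*ˡ (𝟙 (y ≡ᵇ t ℕ.* suc z)) _))
                  (cong (𝟙 (y ≡ᵇ t ℕ.* suc z) *_)
                        (trans (ΣPairs-factorisation (suc z) (factorisation z) (λ k → + lookup k i) z<n) (exponent-count z z<n))))) ⟩
    sumℤ< n (λ z → 𝟙 (y ≡ᵇ t ℕ.* suc z) * sumℤ< n (λ e → 𝟙 (dv (r i ^ suc e) (suc z))))
      ≡⟨ Σ-ext n (λ z → Σ-*ˡ n (𝟙 (y ≡ᵇ t ℕ.* suc z)) _) ⟩
    sumℤ< n (λ z → sumℤ< n (λ e → 𝟙 (y ≡ᵇ t ℕ.* suc z) * 𝟙 (dv (r i ^ suc e) (suc z))))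
      ≡⟨ Σ-swap n n _ ⟩
    sumℤ< n (λ e → sumℤ< n (λ z → 𝟙 (y ≡ᵇ t ℕ.* suc z) * 𝟙 (dv (r i ^ suc e) (suc z))))
      ≡⟨ Σ-ext n (λ e → Σ-cofactor-dv n y t (r i ^ suc e) y≥1 y≤n t≥1) ⟩
    sumℤ< n (λ e → 𝟙 (dv (t ℕ.* r i ^ suc e) y)) ∎
    where
    h : Vec ℕ m → ℕ → ℤ
    h k u = 𝟙 (y ≡ᵇ t ℕ.* u) * + lookup k i
    too-big : ∀ k j′ → n < powProd r k ℕ.* suc j′ → h k (powProd r k ℕ.* suc j′) ≡ + 0
    too-big k j′ lt = cong (_* + lookup k i) (𝟙-< y (t ℕ.* X) (ℕP.≤-<-trans y≤n (ℕP.<-≤-trans lt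
      (subst (_≤ t ℕ.* X) (ℕP.*-identityˡ X) (ℕP.*-monoˡ-≤ X t≥1)))))
      where
      X : ℕ
      X = powProd r k ℕ.* suc j′
    exchange : ∀ a b c → a * (b * c) ≡ b * (a * c)
    exchange = solve-∀

  cCoeff : ℕ → ℤ
  cCoeff y = ΣPairs (λ k j → + lookup k i * freeMultiples n (powProd r k ℕ.* j) y)

  -- Swap the sum over t = p + 1 to the outside and count for each t.
  cCoeff-freeCount : ∀ y → 1 ≤ y → y ≤ n → cCoeff y ≡ freeCount y
  cCoeff-freeCount y y≥1 y≤n = begin
    ΣPairs (λ k j → + lookup k i * freeMultiples n (powProd r k ℕ.* j) y)
      ≡⟨ ΣPairs-ext {g = λ k j → sumℤ< n (λ p → 𝟙 (rFree r (suc p)) * (𝟙 (y ≡ᵇ suc p ℕ.* (powProd r k ℕ.* j)) * + lookup k i))}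
           (λ k j′ → trans (Σ-*ˡ n (+ lookup k i) _) (Σ-ext n (λ p → rearrange (+ lookup k i) (𝟙 (rFree r (suc p)))
                                                                        (𝟙 (y ≡ᵇ suc p ℕ.* (powProd r k ℕ.* suc j′)))))) ⟩
    ΣPairs (λ k j → sumℤ< n (λ p → 𝟙 (rFree r (suc p)) * (𝟙 (y ≡ᵇ suc p ℕ.* (powProd r k ℕ.* j)) * + lookup k i)))
      ≡⟨ ΣPairs-Σ n _ ⟩
    sumℤ< n (λ p → ΣPairs (λ k j → 𝟙 (rFree r (suc p)) * (𝟙 (y ≡ᵇ suc p ℕ.* (powProd r k ℕ.* j)) * + lookup k i)))
      ≡⟨ Σ-ext n (λ p → trans (sym (ΣPairs-*ˡ (𝟙 (rFree r (suc p))) _))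
           (cong (𝟙 (rFree r (suc p)) *_) (weighted-cofactor-count y (suc p) y≥1 y≤n (s≤s z≤n)))) ⟩
    freeCount y ∎
    where
    rearrange : ∀ a b c → a * (b * c) ≡ b * (c * a)
    rearrange = solve-∀

  -- No nonzero multiple has degree 0.
  cCoeff-zero : cCoeff 0 ≡ + 0
  cCoeff-zero = trans (ΣPairs-ext {g = λ _ _ → + 0} (λ k j′ → trans (cong (+ lookup k i *_) (no-multiple k j′)) (ℤP.*-zeroʳ (+ lookup k i)))) ΣPairs-zero
    where
    no-multiple : ∀ k j′ → freeMultiples n (powProd r k ℕ.* suc j′) 0 ≡ + 0
    no-multiple k j′ = Σ-zero n (λ p _ → trans (cong (λ b → 𝟙 (rFree r (suc p)) * 𝟙 b)
      (≢⇒≡ᵇ-false 0 _ (λ e → ℕP.<-irrefl e (ℕP.<-≤-trans (r^k·j≥1 k j′) (ℕP.m≤n*m _ (suc p))))))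
      (ℤP.*-zeroʳ (𝟙 (rFree r (suc p)))))

  ≤-rᵢ* : ∀ u → u ≤ r i ℕ.* u
  ≤-rᵢ* u = subst (_≤ r i ℕ.* u) (ℕP.*-identityˡ u) (ℕP.*-monoˡ-≤ u (r≥1 i))

  -- Σ_{x ≤ n} [r_i r_i^x j ∣ y] = Σ_{e<n} [j r_i^{e+1} ∣ y]: reindex x = e,
  -- and drop the term x = n, which is too large to divide y.
  shift-exponent : ∀ y j′ → 1 ≤ y → y ≤ n → sumℤ< (suc n) (λ x → 𝟙 (dv (r i ℕ.* (r i ^ x ℕ.* suc j′)) y))
                        ≡ sumℤ< n (λ e → 𝟙 (dv (suc j′ ℕ.* r i ^ suc e) y))
  shift-exponent y j′ y≥1 y≤n = begin
    sumℤ< n (λ x → 𝟙 (dv (r i ℕ.* (r i ^ x ℕ.* suc j′)) y)) + 𝟙 (dv (r i ℕ.* (r i ^ n ℕ.* suc j′)) y)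
      ≡⟨ cong₂ _+_ (Σ-ext n (λ x → cong (λ u → 𝟙 (dv u y)) (reorder (r i) (r i ^ x) (suc j′))))
           (𝟙-dv-big _ y y≥1 (ℕP.≤-<-trans y≤n (ℕP.<-≤-trans (<-^ (r i) n (r≥2 i))
              (ℕP.≤-trans (ℕP.m≤m*n (r i ^ n) (suc j′)) (≤-rᵢ* (r i ^ n ℕ.* suc j′)))))) ⟩
    sumℤ< n (λ e → 𝟙 (dv (suc j′ ℕ.* r i ^ suc e) y)) + + 0 ≡⟨ ℤP.+-identityʳ _ ⟩
    sumℤ< n (λ e → 𝟙 (dv (suc j′ ℕ.* r i ^ suc e) y)) ∎
    where
    reorder : ∀ a b c → a ℕ.* (b ℕ.* c) ≡ c ℕ.* (a ℕ.* b)
    reorder a b c = begin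
      a ℕ.* (b ℕ.* c) ≡⟨ ℕP.*-comm a (b ℕ.* c) ⟩
      b ℕ.* c ℕ.* a   ≡⟨ cong (ℕ._* a) (ℕP.*-comm b c) ⟩
      c ℕ.* b ℕ.* a   ≡⟨ ℕP.*-assoc c b a ⟩
      c ℕ.* (b ℕ.* a) ≡⟨ cong (c ℕ.*_) (ℕP.*-comm b a) ⟩
      c ℕ.* (a ℕ.* b) ∎


  -- [q^y] B as a sum over u < n (terms with r_i u > y vanish).
  bracketB-upto-n : ∀ y → 1 ≤ y → y ≤ n →
    bracketB r i y ≡ sumℤ< n (λ u → 𝟙 (rFreeExcept r i (suc u)) * 𝟙 (dv (r i ℕ.* suc u) y))
  bracketB-upto-n y y≥1 y≤n = trans (bracketB-coeff r i (r≥1 i) y)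
    (sym (Σ-extend y n _ y≤n (λ u y≤u _ → trans (cong (𝟙 (rFreeExcept r i (suc u)) *_)
      (𝟙-dv-big (r i ℕ.* suc u) y y≥1 (ℕP.<-≤-trans (s≤s y≤u) (≤-rᵢ* (suc u))))) (ℤP.*-zeroʳ (𝟙 (rFreeExcept r i (suc u)))))))

  -- The right bracket: the u free apart from r_i are exactly the r_i^x j
  -- with j free, i.e. the pairs (k, j) with k supported at i.
  bracketB-freeCount : ∀ y → 1 ≤ y → y ≤ n → bracketB r i y ≡ freeCount y
  bracketB-freeCount y y≥1 y≤n = begin
    bracketB r i y
      ≡⟨ bracketB-upto-n y y≥1 y≤n ⟩
    sumℤ< n (λ u → 𝟙 (rFreeExcept r i (suc u)) * 𝟙 (dv (r i ℕ.* suc u) y))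
      ≡⟨ Σ-cong n (λ u u<n → cong (_* 𝟙 (dv (r i ℕ.* suc u) y))
           (trans (cong 𝟙 (rFreeExcept-onlyAt (suc u) (factorisation u)))
                  (sym (ΣPairs-factorisation (suc u) (factorisation u) (λ k → 𝟙 (onlyAt i k)) u<n)))) ⟩
    sumℤ< n (λ u → ΣPairs (λ k j → 𝟙 (powProd r k ℕ.* j ≡ᵇ suc u) * 𝟙 (onlyAt i k)) * 𝟙 (dv (r i ℕ.* suc u) y))
      ≡⟨ Σ-ext n (λ u → trans (ΣPairs-*ʳ (𝟙 (dv (r i ℕ.* suc u) y)) _)
           (ΣPairs-ext (λ k j′ → ℤP.*-assoc (𝟙 (powProd r k ℕ.* suc j′ ≡ᵇ suc u)) (𝟙 (onlyAt i k)) (𝟙 (dv (r i ℕ.* suc u) y))))) ⟩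
    sumℤ< n (λ u → ΣPairs (λ k j → 𝟙 (powProd r k ℕ.* j ≡ᵇ suc u) * h k (suc u)))
      ≡⟨ sym (ΣPairs-Σ n _) ⟩
    ΣPairs (λ k j → sumℤ< n (λ u → 𝟙 (powProd r k ℕ.* j ≡ᵇ suc u) * h k (suc u)))
      ≡⟨ ΣPairs-ext {g = λ k j → h k (powProd r k ℕ.* j)}
           (λ k j′ → Σ-pick-suc n (powProd r k ℕ.* suc j′) (h k) (r^k·j≥1 k j′) (too-big k j′)) ⟩
    ΣPairs (λ k j → h k (powProd r k ℕ.* j))
      ≡⟨ ΣPairs-def _ ⟩
    sumℤ< n (λ j′ → 𝟙 (rFree r (suc j′)) * ΣL (vecsBounded m n) (λ k → 𝟙 (onlyAt i k) * 𝟙 (dv (r i ℕ.* (powProd r k ℕ.* suc j′)) y)))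
      ≡⟨ Σ-ext n (λ j′ → cong (𝟙 (rFree r (suc j′)) *_) (trans (Σ-vecs-onlyAt m n i _)
           (Σ-ext (suc n) (λ x → cong (λ u → 𝟙 (dv (r i ℕ.* (u ℕ.* suc j′)) y)) (powProd-single r i x))))) ⟩
    sumℤ< n (λ j′ → 𝟙 (rFree r (suc j′)) * sumℤ< (suc n) (λ x → 𝟙 (dv (r i ℕ.* (r i ^ x ℕ.* suc j′)) y)))
      ≡⟨ Σ-ext n (λ j′ → cong (𝟙 (rFree r (suc j′)) *_) (shift-exponent y j′ y≥1 y≤n)) ⟩
    freeCount y ∎
    where
    h : Vec ℕ m → ℕ → ℤ
    h k u = 𝟙 (onlyAt i k) * 𝟙 (dv (r i ℕ.* u) y)
    too-big : ∀ k j′ → n < powProd r k ℕ.* suc j′ → h k (powProd r k ℕ.* suc j′) ≡ + 0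
    too-big k j′ lt = trans (cong (𝟙 (onlyAt i k) *_) (𝟙-dv-big _ y y≥1 (ℕP.≤-<-trans y≤n (ℕP.<-≤-trans lt (≤-rᵢ* _)))))
                            (ℤP.*-zeroʳ (𝟙 (onlyAt i k)))

  -- Step (2) for all y ≤ n (both sides vanish at y = 0).
  cCoeff-bracketB : ∀ y → y ≤ n → cCoeff y ≡ bracketB r i y
  cCoeff-bracketB zero _ = cCoeff-zero
  cCoeff-bracketB (suc y) le = trans (cCoeff-freeCount (suc y) (s≤s z≤n) le) (sym (bracketB-freeCount (suc y) (s≤s z≤n) le))

  c-as-ΣPairs : + c r i n ≡ ΣPairs (λ k j → + lookup k i * + W r (powProd r k ℕ.* j) n)
  c-as-ΣPairs = begin
    + c r i n
      ≡⟨ +-sumℕ< n _ ⟩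
    sumℤ< n (λ j′ → + (if rFree r (suc j′) then sum (map (λ k → lookup k i ℕ.* W r (powProd r k ℕ.* suc j′) n) (vecsBounded m n)) else 0))
      ≡⟨ Σ-ext n (λ j′ → trans (+-if (rFree r (suc j′)) _ 0) (trans (𝟙-if (rFree r (suc j′)) _)
           (cong (𝟙 (rFree r (suc j′)) *_) (trans (+-sum (vecsBounded m n) _)
              (ΣL-ext (vecsBounded m n) (λ k → ℤP.pos-* (lookup k i) _)))))) ⟩
    sumℤ< n (λ j′ → 𝟙 (rFree r (suc j′)) * ΣL (vecsBounded m n) (λ k → + lookup k i * + W r (powProd r k ℕ.* suc j′) n))
      ≡⟨ sym (ΣPairs-def _) ⟩
    ΣPairs (λ k j → + lookup k i * + W r (powProd r k ℕ.* j) n) ∎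

  c-series : + c r i n ≡ (Φ r ⊛ bracketB r i) n
  c-series = begin
    + c r i n
      ≡⟨ c-as-ΣPairs ⟩
    ΣPairs (λ k j → + lookup k i * + W r (powProd r k ℕ.* j) n)
      ≡⟨ ΣPairs-ext {g = λ k j → sumℤ< (suc n) (λ a → Φ r a * (+ lookup k i * freeMultiples n (powProd r k ℕ.* j) (n ∸ a)))}
           W-expanded ⟩
    ΣPairs (λ k j → sumℤ< (suc n) (λ a → Φ r a * (+ lookup k i * freeMultiples n (powProd r k ℕ.* j) (n ∸ a))))
      ≡⟨ ΣPairs-Σ (suc n) _ ⟩
    sumℤ< (suc n) (λ a → ΣPairs (λ k j → Φ r a * (+ lookup k i * freeMultiples n (powProd r k ℕ.* j) (n ∸ a))))
      ≡⟨ Σ-ext (suc n) (λ a → sym (ΣPairs-*ˡ (Φ r a) _)) ⟩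
    sumℤ< (suc n) (λ a → Φ r a * cCoeff (n ∸ a))
      ≡⟨ Σ-ext (suc n) (λ a → cong (Φ r a *_) (cCoeff-bracketB (n ∸ a) (ℕP.m∸n≤m n a))) ⟩
    (Φ r ⊛ bracketB r i) n ∎
    where
    exchange : ∀ a b c → a * (b * c) ≡ b * (a * c)
    exchange = solve-∀
    W-expanded : ∀ k j′ → + lookup k i * + W r (powProd r k ℕ.* suc j′) n
      ≡ sumℤ< (suc n) (λ a → Φ r a * (+ lookup k i * freeMultiples n (powProd r k ℕ.* suc j′) (n ∸ a)))
    W-expanded k j′ = begin
      + lookup k i * + W r X n
        ≡⟨ cong (+ lookup k i *_) (Threshold.W-series X (r^k·j≥1 k j′) n) ⟩
      + lookup k i * sumℤ< (suc n) (λ a → Φ r a * freeMultiples n X (n ∸ a))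
        ≡⟨ Σ-*ˡ (suc n) (+ lookup k i) _ ⟩
      sumℤ< (suc n) (λ a → + lookup k i * (Φ r a * freeMultiples n X (n ∸ a)))
        ≡⟨ Σ-ext (suc n) (λ a → exchange (+ lookup k i) (Φ r a) (freeMultiples n X (n ∸ a))) ⟩
      sumℤ< (suc n) (λ a → Φ r a * (+ lookup k i * freeMultiples n X (n ∸ a))) ∎
      where
      X : ℕ
      X = powProd r k ℕ.* suc j′

card≤ : ∀ {m} (S : Vec Bool m) → card S ≤ m
card≤ [] = z≤n
card≤ (true ∷ S) = s≤s (card≤ S)
card≤ (false ∷ S) = ℕP.m≤n⇒m≤1+n (card≤ S)

card<-missing : ∀ {m} (S : Vec Bool m) i → lookup S i ≡ false → suc (card S) ≤ m
card<-missing (false ∷ S) zero _ = s≤s (card≤ S)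
card<-missing (true ∷ S) (suc i) e = s≤s (card<-missing S i e)
card<-missing (false ∷ S) (suc i) e = ℕP.m≤n⇒m≤1+n (card<-missing S i e)

prodSub≥1 : ∀ {m} (r : Fin m → ℕ) → (∀ l → 1 ≤ r l) → ∀ S → 1 ≤ prodSub r S
prodSub≥1 {zero} r h S = s≤s z≤n
prodSub≥1 {suc m} r h (b ∷ S) = ℕP.*-mono-≤ (factor≥1 b) (prodSub≥1 (λ l → r (suc l)) (λ l → h (suc l)) S)
  where
  factor≥1 : ∀ b → 1 ≤ (if b then r zero else 1)
  factor≥1 true = h zero
  factor≥1 false = s≤s z≤n

coprime-prodSub : ∀ {m} (r : Fin (suc m) → ℕ) → PairwiseCoprime r → ∀ S → Coprime (r zero) (prodSub (λ l → r (suc l)) S)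
coprime-prodSub r pw S = coprime-prodFin (r zero) _ (λ l → factor (lookup S l) l)
  where
  factor : ∀ b l → Coprime (r zero) (if b then r (suc l) else 1)
  factor true l = pw zero (suc l) (λ ())
  factor false l = coprime-1 (r zero)

lookup-∅ : ∀ {m} (i : Fin m) → lookup (replicate m false) i ≡ false
lookup-∅ zero = refl
lookup-∅ (suc i) = lookup-∅ i

card-∅ : ∀ m → card (replicate m false) ≡ 0
card-∅ zero = refl
card-∅ (suc m) = card-∅ m

prodSub-∅ : ∀ {m} (r : Fin m → ℕ) → prodSub r (replicate m false) ≡ 1
prodSub-∅ {zero} r = refl
prodSub-∅ {suc m} r = trans (ℕP.+-identityʳ _) (prodSub-∅ (λ l → r (suc l)))

Σ-subsets-∅ : ∀ m (G : Vec Bool m → ℤ) → ΣL (subsets m) (λ S → 𝟙 (card S ≡ᵇ 0) * G S) ≡ G (replicate m false)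
Σ-subsets-∅ zero G = trans (ℤP.+-identityʳ _) (ℤP.*-identityˡ _)
Σ-subsets-∅ (suc m) G = trans (subsets-split m _)
  (trans (cong₂ _+_ (ΣL-zero (subsets m)) (Σ-subsets-∅ m (λ S → G (false ∷ S)))) (ℤP.+-identityˡ _))

Σ-sign : ∀ K c → c ≤ K → sumℤ< K (λ k → 𝟙 (c ≡ᵇ suc k) * sign (suc k)) ≡ 𝟙 (1 ≤ᵇ c) * sign c
Σ-sign K zero _ = Σ-zero K (λ k _ → refl)
Σ-sign K (suc c) le = begin
  sumℤ< K (λ k → 𝟙 (c ≡ᵇ k) * sign (suc k)) ≡⟨ Σ-ext K (λ k → cong (λ b → 𝟙 b * sign (suc k)) (≡ᵇ-sym c k)) ⟩
  sumℤ< K (λ k → 𝟙 (k ≡ᵇ c) * sign (suc k)) ≡⟨ Σ-pick K c (λ k → sign (suc k)) ⟩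
  𝟙 (c ℕ.<ᵇ K) * sign (suc c)               ≡⟨ cong (λ b → 𝟙 b * sign (suc c)) (≤⇒≤ᵇ-true {suc c} {K} le) ⟩
  + 1 * sign (suc c)                        ∎

-- Splitting on whether r_1 belongs to S: the sieve sum acquires the factor
-- 1 - [r_1 ∣ w] (using that r_1 is coprime to the other r_l).  The weight
-- μ may depend on the rest of S.
sieve-step : ∀ {m} (r : Fin (suc m) → ℕ) → PairwiseCoprime r → ∀ w (μ : Vec Bool m → ℤ) →
  ΣL (subsets (suc m)) (λ S → μ (tail S) * (sign (card S) * 𝟙 (dv (prodSub r S) w)))
    ≡ (+ 1 - 𝟙 (dv (r zero) w)) * ΣL (subsets m) (λ S → μ S * (sign (card S) * 𝟙 (dv (prodSub (λ l → r (suc l)) S) w)))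
sieve-step {m} r pw w μ = begin
  ΣL (subsets (suc m)) (λ S → μ (tail S) * (sign (card S) * 𝟙 (dv (prodSub r S) w)))
    ≡⟨ subsets-split m _ ⟩
  ΣL (subsets m) (λ S → μ S * (sign (1 ℕ.+ card S) * 𝟙 (dv (r zero ℕ.* prodSub r′ S) w)))
   + ΣL (subsets m) (λ S → μ S * (sign (0 ℕ.+ card S) * 𝟙 (dv (1 ℕ.* prodSub r′ S) w)))
    ≡⟨ cong₂ _+_ (ΣL-ext (subsets m) with-r₁) (ΣL-ext (subsets m) without-r₁) ⟩
  ΣL (subsets m) (λ S → - d * rest S) + ΣL (subsets m) rest
    ≡⟨ cong (_+ ΣL (subsets m) rest) (sym (ΣL-*ˡ (subsets m) (- d) rest)) ⟩
  - d * ΣL (subsets m) rest + ΣL (subsets m) rest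
    ≡⟨ factor d (ΣL (subsets m) rest) ⟩
  (+ 1 - d) * ΣL (subsets m) rest ∎
  where
  r′ : Fin m → ℕ
  r′ l = r (suc l)
  d : ℤ
  d = 𝟙 (dv (r zero) w)
  rest : Vec Bool m → ℤ
  rest S = μ S * (sign (card S) * 𝟙 (dv (prodSub r′ S) w))
  sign-suc : ∀ k → sign (suc k) ≡ - sign k
  sign-suc k = ℤP.-1*i≡-i (sign k)
  with-r₁ : ∀ S → μ S * (sign (1 ℕ.+ card S) * 𝟙 (dv (r zero ℕ.* prodSub r′ S) w)) ≡ - d * rest S
  with-r₁ S = trans (cong (μ S *_) (cong₂ _*_ (sign-suc (card S)) (𝟙-dv-* (r zero) _ w (coprime-prodSub r pw S))))
                    (ring (μ S) (sign (card S)) d (𝟙 (dv (prodSub r′ S) w)))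
    where
    ring : ∀ n s a b → n * (- s * (a * b)) ≡ - a * (n * (s * b))
    ring = solve-∀
  without-r₁ : ∀ S → μ S * (sign (0 ℕ.+ card S) * 𝟙 (dv (1 ℕ.* prodSub r′ S) w)) ≡ rest S
  without-r₁ S = cong (λ u → μ S * (sign (card S) * 𝟙 (dv u w))) (ℕP.*-identityˡ (prodSub r′ S))
  factor : ∀ a b → - a * b + b ≡ (+ 1 - a) * b
  factor = solve-∀

𝟙-not-∨ : ∀ d A → 𝟙 (not (d ∨ A)) ≡ (+ 1 - 𝟙 d) * 𝟙 (not A)
𝟙-not-∨ true A = refl
𝟙-not-∨ false true = refl
𝟙-not-∨ false false = refl

𝟙-not-∧ : ∀ d E → 𝟙 (not d ∧ E) ≡ (+ 1 - 𝟙 d) * 𝟙 E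
𝟙-not-∧ true E = refl
𝟙-not-∧ false true = refl
𝟙-not-∧ false false = refl

sieve : ∀ {m} (r : Fin m → ℕ) → PairwiseCoprime r → ∀ w →
  ΣL (subsets m) (λ S → sign (card S) * 𝟙 (dv (prodSub r S) w)) ≡ 𝟙 (rFree r w)
sieve {zero} r pw w = cong (λ b → + 1 * 𝟙 b + + 0) (dv-true (divides w (sym (ℕP.*-identityʳ w))))
sieve {suc m} r pw w = begin
  ΣL (subsets (suc m)) (λ S → sign (card S) * 𝟙 (dv (prodSub r S) w))
    ≡⟨ ΣL-ext (subsets (suc m)) (λ S → sym (ℤP.*-identityˡ _)) ⟩
  ΣL (subsets (suc m)) (λ S → + 1 * (sign (card S) * 𝟙 (dv (prodSub r S) w)))
    ≡⟨ sieve-step r pw w (λ _ → + 1) ⟩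
  (+ 1 - 𝟙 (dv (r zero) w)) * ΣL (subsets m) (λ S → + 1 * (sign (card S) * 𝟙 (dv (prodSub r′ S) w)))
    ≡⟨ cong ((+ 1 - 𝟙 (dv (r zero) w)) *_) (trans (ΣL-ext (subsets m) (λ S → ℤP.*-identityˡ _)) (sieve r′ (PairwiseCoprime-tail r pw) w)) ⟩
  (+ 1 - 𝟙 (dv (r zero) w)) * 𝟙 (rFree r′ w)
    ≡⟨ sym (𝟙-not-∨ (dv (r zero) w) _) ⟩
  𝟙 (rFree r w) ∎
  where
  r′ : Fin m → ℕ
  r′ l = r (suc l)

sieve-except : ∀ {m} (r : Fin m → ℕ) → PairwiseCoprime r → ∀ i w →
  ΣL (subsets m) (λ S → 𝟙 (not (lookup S i)) * (sign (card S) * 𝟙 (dv (prodSub r S) w))) ≡ 𝟙 (rFreeExcept r i w)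
sieve-except {suc m} r pw zero w = begin
  ΣL (subsets (suc m)) (λ S → 𝟙 (not (lookup S zero)) * (sign (card S) * 𝟙 (dv (prodSub r S) w)))
    ≡⟨ subsets-split m _ ⟩
  ΣL (subsets m) (λ S → + 0) + ΣL (subsets m) (λ S → + 1 * (sign (card S) * 𝟙 (dv (1 ℕ.* prodSub r′ S) w)))
    ≡⟨ cong₂ _+_ (ΣL-zero (subsets m)) (ΣL-ext (subsets m) (λ S → trans (ℤP.*-identityˡ _)
         (cong (λ u → sign (card S) * 𝟙 (dv u w)) (ℕP.*-identityˡ (prodSub r′ S))))) ⟩
  + 0 + ΣL (subsets m) (λ S → sign (card S) * 𝟙 (dv (prodSub r′ S) w))
    ≡⟨ trans (ℤP.+-identityˡ _) (sieve r′ (PairwiseCoprime-tail r pw) w) ⟩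
  𝟙 (rFree r′ w)
    ≡⟨ cong 𝟙 (sym (allFin-not (λ l → dv (r′ l) w))) ⟩
  𝟙 (rFreeExcept r zero w) ∎
  where
  r′ : Fin m → ℕ
  r′ l = r (suc l)
sieve-except {suc m} r pw (suc i) w = begin
  ΣL (subsets (suc m)) (λ S → 𝟙 (not (lookup S (suc i))) * (sign (card S) * 𝟙 (dv (prodSub r S) w)))
    ≡⟨ ΣL-ext (subsets (suc m)) (λ { (b ∷ S) → refl }) ⟩
  ΣL (subsets (suc m)) (λ S → 𝟙 (not (lookup (tail S) i)) * (sign (card S) * 𝟙 (dv (prodSub r S) w)))
    ≡⟨ sieve-step r pw w (λ S → 𝟙 (not (lookup S i))) ⟩
  (+ 1 - 𝟙 (dv (r zero) w)) * ΣL (subsets m) (λ S → 𝟙 (not (lookup S i)) * (sign (card S) * 𝟙 (dv (prodSub r′ S) w)))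
    ≡⟨ cong ((+ 1 - 𝟙 (dv (r zero) w)) *_) (sieve-except r′ (PairwiseCoprime-tail r pw) i w) ⟩
  (+ 1 - 𝟙 (dv (r zero) w)) * 𝟙 (rFreeExcept r′ i w)
    ≡⟨ sym (𝟙-not-∧ (dv (r zero) w) _) ⟩
  𝟙 (rFreeExcept r (suc i) w) ∎
  where
  r′ : Fin m → ℕ
  r′ l = r (suc l)

-- The two brackets agree: expanding A by |S| = k and adding the S = ∅ term
-- gives the sieve sum Σ_{S ∌ i} (-1)^|S| L(r_i Π_S r_l), and the sieve
-- turns that into B.

module Brackets {m} (r : Fin m → ℕ) (r≥1 : ∀ l → 1 ≤ r l) (pw : PairwiseCoprime r) (i : Fin m) where

  L : ℕ → Vec Bool m → ℤ
  L y S = lambert (r i ℕ.* prodSub r S) y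

  excluded : Vec Bool m → ℤ
  excluded S = 𝟙 (not (lookup S i))

  sieveSum : ℕ → ℤ
  sieveSum y = ΣL (subsets m) (λ S → excluded S * sign (card S) * L y S)

  bracketA-by-subsets : ∀ y →
    bracketA r i y ≡ lambert (r i) y + ΣL (subsets m) (λ S → excluded S * (𝟙 (1 ≤ᵇ card S) * sign (card S)) * L y S)
  bracketA-by-subsets y = cong (λ x → lambert (r i) y + x) (begin
    sumS (map g (upTo (m ∸ 1))) y
      ≡⟨ trans (sumS-map (upTo (m ∸ 1)) g y) (ΣL-upTo (m ∸ 1) (λ k → g k y)) ⟩
    sumℤ< (m ∸ 1) (λ k → sign (suc k) * sumS (map (λ S → lambert (r i ℕ.* prodSub r S)) (filterᵇ (ofSize k) (subsets m))) y)
      ≡⟨ Σ-ext (m ∸ 1) (λ k → cong (sign (suc k) *_) (trans (sumS-map (filterᵇ (ofSize k) (subsets m)) _ y)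
            (ΣL-filter (subsets m) (ofSize k) (L y)))) ⟩
    sumℤ< (m ∸ 1) (λ k → sign (suc k) * ΣL (subsets m) (λ S → 𝟙 (ofSize k S) * L y S))
      ≡⟨ Σ-ext (m ∸ 1) (λ k → trans (ΣL-*ˡ (subsets m) (sign (suc k)) _)
            (ΣL-ext (subsets m) (λ S → regroup (sign (suc k)) (not (lookup S i)) (card S ≡ᵇ suc k) (L y S)))) ⟩
    sumℤ< (m ∸ 1) (λ k → ΣL (subsets m) (λ S → excluded S * (𝟙 (card S ≡ᵇ suc k) * sign (suc k)) * L y S))
      ≡⟨ sym (ΣL-Σ (subsets m) (m ∸ 1) _) ⟩
    ΣL (subsets m) (λ S → sumℤ< (m ∸ 1) (λ k → excluded S * (𝟙 (card S ≡ᵇ suc k) * sign (suc k)) * L y S))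
      ≡⟨ ΣL-ext (subsets m) (λ S → trans (sym (Σ-*ʳ (m ∸ 1) (L y S) _))
            (cong (_* L y S) (trans (sym (Σ-*ˡ (m ∸ 1) (excluded S) _)) (collect-sizes S)))) ⟩
    ΣL (subsets m) (λ S → excluded S * (𝟙 (1 ≤ᵇ card S) * sign (card S)) * L y S) ∎)
    where
    ofSize : ℕ → Vec Bool m → Bool
    ofSize k S = not (lookup S i) ∧ (card S ≡ᵇ suc k)
    g : ℕ → Series
    g k = sign (suc k) ⊙ sumS (map (λ S → lambert (r i ℕ.* prodSub r S)) (filterᵇ (ofSize k) (subsets m)))
    regroup : ∀ s a b x → s * (𝟙 (a ∧ b) * x) ≡ 𝟙 a * (𝟙 b * s) * x
    regroup s a b x rewrite 𝟙-∧ a b = ring s (𝟙 a) (𝟙 b) x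
      where
      ring : ∀ s a b x → s * (a * b * x) ≡ a * (b * s) * x
      ring = solve-∀
    -- a subset S ∌ i has size at most m - 1, so exactly one k < m - 1 matches
    collect-sizes : ∀ S → excluded S * sumℤ< (m ∸ 1) (λ k → 𝟙 (card S ≡ᵇ suc k) * sign (suc k))
                          ≡ excluded S * (𝟙 (1 ≤ᵇ card S) * sign (card S))
    collect-sizes S with lookup S i in e
    ... | true = refl
    ... | false = cong (+ 1 *_) (Σ-sign (m ∸ 1) (card S) (ℕP.≤-pred (subst (suc (card S) ≤_)
                    (sym (ℕP.m+[n∸m]≡n {1} {m} (ℕP.≤-trans (s≤s z≤n) (card<-missing S i e)))) (card<-missing S i e))))

  -- The S = ∅ term is the Lambert series of r_i itself.
  bracketA-sieveSum : ∀ y → bracketA r i y ≡ sieveSum y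
  bracketA-sieveSum y = begin
    bracketA r i y
      ≡⟨ bracketA-by-subsets y ⟩
    lambert (r i) y + ΣL (subsets m) nonempty
      ≡⟨ cong (_+ ΣL (subsets m) nonempty) (sym (trans (Σ-subsets-∅ m term) empty-term)) ⟩
    ΣL (subsets m) (λ S → 𝟙 (card S ≡ᵇ 0) * term S) + ΣL (subsets m) nonempty
      ≡⟨ sym (ΣL-+ (subsets m) _ _) ⟩
    ΣL (subsets m) (λ S → 𝟙 (card S ≡ᵇ 0) * term S + nonempty S)
      ≡⟨ ΣL-ext (subsets m) (λ S → sym (empty-or-not S)) ⟩
    sieveSum y ∎
    where
    term : Vec Bool m → ℤ
    term S = excluded S * sign (card S) * L y S
    nonempty : Vec Bool m → ℤ
    nonempty S = excluded S * (𝟙 (1 ≤ᵇ card S) * sign (card S)) * L y S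
    empty-or-not : ∀ S → term S ≡ 𝟙 (card S ≡ᵇ 0) * term S + nonempty S
    empty-or-not S = trans (sym (trans (cong (_* term S) (split (card S))) (ℤP.*-identityˡ _)))
                           (ring (𝟙 (card S ≡ᵇ 0)) (𝟙 (1 ≤ᵇ card S)) (excluded S) (sign (card S)) (L y S))
      where
      split : ∀ c → 𝟙 (c ≡ᵇ 0) + 𝟙 (1 ≤ᵇ c) ≡ + 1
      split zero = refl
      split (suc c) = refl
      ring : ∀ x z a s l → (x + z) * (a * s * l) ≡ x * (a * s * l) + a * (z * s) * l
      ring = solve-∀
    empty-term : term (replicate m false) ≡ lambert (r i) y
    empty-term rewrite lookup-∅ i | card-∅ m | prodSub-∅ r | ℕP.*-identityʳ (r i) = ℤP.*-identityˡ (lambert (r i) y)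

  -- Expanding each Lambert series and sieving gives B.
  sieveSum-bracketB : ∀ y → sieveSum y ≡ bracketB r i y
  sieveSum-bracketB y = begin
    sieveSum y
      ≡⟨ ΣL-ext (subsets m) (λ S → trans (cong (excluded S * sign (card S) *_)
           (lambert-coeff (r i) (prodSub r S) y (r≥1 i) (prodSub≥1 r r≥1 S)))
           (trans (Σ-*ˡ y (excluded S * sign (card S)) _) (Σ-ext y (λ w → ring (excluded S) (sign (card S))
                                                                             (𝟙 (dv (prodSub r S) (suc w))) (𝟙 (dv (r i ℕ.* suc w) y)))))) ⟩
    ΣL (subsets m) (λ S → sumℤ< y (λ w → 𝟙 (dv (r i ℕ.* suc w) y) * (excluded S * (sign (card S) * 𝟙 (dv (prodSub r S) (suc w))))))
      ≡⟨ ΣL-Σ (subsets m) y _ ⟩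
    sumℤ< y (λ w → ΣL (subsets m) (λ S → 𝟙 (dv (r i ℕ.* suc w) y) * (excluded S * (sign (card S) * 𝟙 (dv (prodSub r S) (suc w))))))
      ≡⟨ Σ-ext y (λ w → trans (sym (ΣL-*ˡ (subsets m) (𝟙 (dv (r i ℕ.* suc w) y)) _))
            (trans (cong (𝟙 (dv (r i ℕ.* suc w) y) *_) (sieve-except r pw i (suc w)))
                   (ℤP.*-comm (𝟙 (dv (r i ℕ.* suc w) y)) _))) ⟩
    sumℤ< y (λ w → 𝟙 (rFreeExcept r i (suc w)) * 𝟙 (dv (r i ℕ.* suc w) y))
      ≡⟨ sym (bracketB-coeff r i (r≥1 i) y) ⟩
    bracketB r i y ∎
    where
    ring : ∀ a s d e → a * s * (d * e) ≡ e * (a * (s * d))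
    ring = solve-∀

  brackets-agree : bracketA r i ≗ bracketB r i
  brackets-agree y = trans (bracketA-sieveSum y) (sieveSum-bracketB y)

theorem2p4 : (m : ℕ) → 1 ≤ m → (r : Fin m → ℕ) → (∀ l → 2 ≤ r l)
    → (∀ l l′ → l ≢ l′ → Coprime (r l) (r l′)) → (i : Fin m)
    → ((N : ℕ) → cSeries r i N ≡ (Φ r ⊛ bracketA r i) N)
      × ((N : ℕ) → (Φ r ⊛ bracketA r i) N ≡ (Φ r ⊛ bracketB r i) N)
theorem2p4 m _ r r≥2 coprime i = c-equals-A , A-equals-B
  where
  r≥1 : ∀ l → 1 ≤ r l
  r≥1 l = ℕP.≤-trans (s≤s z≤n) (r≥2 l)

  c-equals-B : (N : ℕ) → cSeries r i N ≡ (Φ r ⊛ bracketB r i) N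
  c-equals-B N = MultiplicityCount.c-series r r≥2 coprime i N

  A-equals-B : (N : ℕ) → (Φ r ⊛ bracketA r i) N ≡ (Φ r ⊛ bracketB r i) N
  A-equals-B = ⊛-congʳ (Φ r) (Brackets.brackets-agree r r≥1 coprime i)

  c-equals-A : (N : ℕ) → cSeries r i N ≡ (Φ r ⊛ bracketA r i) N
  c-equals-A N = trans (c-equals-B N) (sym (A-equals-B N))
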